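{- Let $(\lambda^{(1)}|\cdots|\lambda^{(r)})\in\mathrm{Par}^r$ and $(n_1|\cdots|n_r)$ with $n_j\ge\ell(\lambda^{(j)})$ for all $1\le j\le r$ and $n_i\ge\ell(\lambda^{(i)})+1$ for some $1\le i\le r$. Then $$\Xi^{(n_i)}_i\Big(\mathcal{S}^{(n_1|\cdots|n_r)}_{(\lambda^{(1)}|\cdots|\lambda^{(r)})}\Big)=\mathcal{S}^{(n_1|\cdots|n_{i-1}|n_i-1|n_{i+1}|\cdots|n_r)}_{(\lambda^{(1)}|\cdots|\lambda^{(r)})}.$$
   Context: Key polynomials $\mathcal{K}_\alpha$: unique polynomials with $\mathcal{K}_\alpha=x^\alpha$ if $\alpha$ weakly decreasing and $\mathcal{K}_{s_i\alpha}=\xi_i\mathcal{K}_\alpha$ whenever $\alpha_i>\alpha_{i+1}$, $\xi_if=\frac{x_if-x_{i+1}s_if}{x_i-x_{i+1}}$. $\mathrm{rev}(\lambda)=(\lambda_{\ell(\lambda)},\dots,\lambda_1)$, $*$ concatenation, $0^m$ $m$ zeros. For $n_j\ge\ell(\lambda^{(j)})$, $\mathcal{S}^{(n_1|\cdots|n_r)}_{(\lambda)}=\mathcal{K}_\gamma(x_{1,1},\dots,x_{1,n_1},\dots,x_{r,1},\dots,x_{r,n_r})$ with $\gamma=(0^{n_1-\ell(\lambda^{(1)})}*\mathrm{rev}(\lambda^{(1)}))*\cdots*(0^{n_r-\ell(\lambda^{(r)})}*\mathrm{rev}(\lambda^{(r)}))$, an element of $\mathcal{P}_{(n_1|\cdots|n_r)}=\bigotimes_j\mathbb{Q}[x_{j,1},\dots,x_{j,n_j}]$.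 $\Xi^{(n_i)}_i:\mathcal{P}_{(n_1|\cdots|n_r)}\to\mathcal{P}_{(n_1|\cdots|n_i-1|\cdots|n_r)}$ is $f\mapsto f|_{x_{i,n_i}=0}$. -}

module Defs where

open import Data.Nat as ℕ using (ℕ; zero; suc; pred; _≤_; _<_; _≟_)
open import Data.Fin as Fin using (Fin; zero; suc; inject₁)
open import Data.Vec as Vec using (Vec; []; _∷_; lookup; _[_]%=_; _[_]≔_; _++_; take; drop; init; last)
import Data.Vec.Properties as VecP
open import Data.List as List using (List; []; _∷_; length; filter; map; replicate)
open import Data.List.Relation.Unary.All using (All)
open import Data.List.Relation.Unary.Linked using (Linked)
open import Data.Rational as ℚ using (ℚ; 0ℚ; 1ℚ)
open import Data.Product using (_×_; _,_; proj₁; proj₂)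
open import Relation.Nullary using (yes; no)
open import Relation.Binary.PropositionalEquality using (_≡_)

-- Polynomials in n variables over ℚ, as formal finite sums of terms
-- c · x^e  (e : Vec ℕ n is the exponent vector).

Mono : ℕ → Set
Mono n = Vec ℕ n

Poly : ℕ → Set
Poly n = List (ℚ × Mono n)

coeff : ∀ {n} → Poly n → Mono n → ℚ
coeff [] m = 0ℚ
coeff ((c , e) ∷ p) m with VecP.≡-dec _≟_ e m
... | yes _ = c ℚ.+ coeff p m
... | no _  = coeff p m

infix 4 _≈_
_≈_ : ∀ {n} → Poly n → Poly n → Set
p ≈ q = ∀ m → coeff p m ≡ coeff q m

monomial : ∀ {n} → Mono n → Poly n
monomial α = (1ℚ , α) ∷ []

infixl 6 _⊕_ _⊖_
_⊕_ : ∀ {n} → Poly n → Poly n → Poly n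
p ⊕ q = p List.++ q

neg : ∀ {n} → Poly n → Poly n
neg = map (λ t → ℚ.- proj₁ t , proj₂ t)

_⊖_ : ∀ {n} → Poly n → Poly n → Poly n
p ⊖ q = p ⊕ neg q

mulX : ∀ {n} → Fin n → Poly n → Poly n
mulX j = map (λ t → proj₁ t , (proj₂ t [ j ]%= suc))

swapV : ∀ {A : Set} {m} → Fin m → Vec A (suc m) → Vec A (suc m)
swapV i v = (v [ inject₁ i ]≔ lookup v (suc i)) [ suc i ]≔ lookup v (inject₁ i)

σ : ∀ {m} → Fin m → Poly (suc m) → Poly (suc m)
σ i = map (λ t → proj₁ t , swapV i (proj₂ t))

Decreasing : ∀ {n} → Vec ℕ n → Set
Decreasing {n} α = ∀ (i j : Fin n) → i Fin.≤ j → lookup α j ≤ lookup α i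

-- The characterisation of key polynomials (0-based positions
-- inject₁ i, suc i stand for i, i+1):
--   K_α = x^α if α weakly decreasing,
--   K_{s_i α} = ξ_i K_α whenever α_i > α_{i+1},
-- where ξ_i f = (x_i f - x_{i+1} s_i f)/(x_i - x_{i+1}); since ℚ[x] is a
-- domain the latter is stated equivalently-by-definition of division as
--   (x_i - x_{i+1}) · K_{s_i α} = x_i K_α - x_{i+1} s_i K_α.
record IsKeyPolynomials (K : ∀ {n} → Vec ℕ n → Poly n) : Set where
  field
    key-dominant : ∀ {n} (α : Vec ℕ n) → Decreasing α → K α ≈ monomial α
    key-step : ∀ {m} (α : Vec ℕ (suc m)) (i : Fin m) →
      lookup α (suc i) < lookup α (inject₁ i) →
      (mulX (inject₁ i) (K (swapV i α)) ⊖ mulX (suc i) (K (swapV i α)))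
        ≈ (mulX (inject₁ i) (K α) ⊖ mulX (suc i) (σ i (K α)))

IsPartition : List ℕ → Set
IsPartition λs = Linked (λ a b → b ≤ a) λs × All (0 <_) λs

fillTo : (n : ℕ) → List ℕ → Vec ℕ n
fillTo zero xs = []
fillTo (suc n) [] = 0 ∷ fillTo n []
fillTo (suc n) (x ∷ xs) = x ∷ fillTo n xs

block : (n : ℕ) → List ℕ → Vec ℕ n
block n λs = Vec.reverse (fillTo n λs)

gamma : ∀ {r} (ns : Vec ℕ r) → Vec (List ℕ) r → Vec ℕ (Vec.sum ns)
gamma [] [] = []
gamma (n ∷ ns) (λs ∷ lams) = block n λs ++ gamma ns lams

-- S^{(n_1|⋯|n_r)}_{(λ^(1)|⋯|λ^(r))} = K_γ(x_{1,1},…,x_{r,n_r})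
-- (variables x_{j,k} ordered block by block)
S : (K : ∀ {n} → Vec ℕ n → Poly n) → ∀ {r} (ns : Vec ℕ r) → Vec (List ℕ) r →
    Poly (Vec.sum ns)
S K ns lams = K (gamma ns lams)

-- Ξ_i : set x_{i,n_i} (last variable of block i) to 0.

lastV : ∀ {n} → Vec ℕ n → ℕ
lastV {zero} [] = 0
lastV {suc n} v = last v

initV : ∀ {n} → Vec ℕ n → Vec ℕ (pred n)
initV {zero} [] = []
initV {suc n} v = init v

lastOfBlock : ∀ {r} (ns : Vec ℕ r) (i : Fin r) → Mono (Vec.sum ns) → ℕ
lastOfBlock (n ∷ ns) zero v = lastV (take n v)
lastOfBlock (n ∷ ns) (suc i) v = lastOfBlock ns i (drop n v)

dropInBlock : ∀ {r} (ns : Vec ℕ r) (i : Fin r) →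
  Mono (Vec.sum ns) → Mono (Vec.sum (ns [ i ]%= pred))
dropInBlock (n ∷ ns) zero v = initV (take n v) ++ drop n v
dropInBlock (n ∷ ns) (suc i) v = take n v ++ dropInBlock ns i (drop n v)

Ξ : ∀ {r} (ns : Vec ℕ r) (i : Fin r) →
  Poly (Vec.sum ns) → Poly (Vec.sum (ns [ i ]%= pred))
Ξ ns i p = map (λ t → proj₁ t , dropInBlock ns i (proj₂ t))
               (filter (λ t → lastOfBlock ns i (proj₂ t) ≟ 0) p)

-- In the exponent vector γ, block i reads 0^(n_i - ℓ) * rev(λ⁽ⁱ⁾) with ℓ = ℓ(λ⁽ⁱ⁾) < n_i:
-- it starts with a zero and increases weakly. A key polynomial K_α is symmetric in
-- x_j, x_{j+1} whenever α_j ≤ α_{j+1}, so setting the last variable of block i to zero has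
-- the same effect as setting the first one to zero; and if α_p = 0, then K_α at x_p = 0 is
-- K of α with its p-th entry removed. Both facts follow from the characterisation of key
-- polynomials by induction on Σ_k k α_k, writing K_α = ξ_i K_{s_i α} at an ascent i of α.
-- The symmetry needs the braid relations of the Demazure operators ξ_i, which are checked
-- after clearing denominators, x_a - x_b being a non-zero-divisor.

module Submission where

open import Defs
open import Data.Nat using (ℕ; suc; pred; _≤_)
open import Data.Fin using (Fin)
open import Data.Vec using (Vec; lookup; _[_]%=_)
open import Data.List using (List; length)

open import Data.Nat as ℕ using (zero; _<_; z≤n; s≤s; _≟_)
import Data.Nat.Properties as ℕP
open import Data.Fin as Fin using (zero; suc; inject₁; punchIn; toℕ)
import Data.Fin.Properties as FinP
open import Data.Fin.Permutation.Components using (transpose)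
open import Data.Vec as Vec using ([]; _∷_; _[_]≔_; insertAt; removeAt)
import Data.Vec.Properties as VecP
open import Data.List as List using ([]; _∷_; filter; map)
open import Data.Rational as ℚ using (ℚ; 0ℚ; 1ℚ; _+_; -_; _-_)
import Data.Rational.Properties as ℚP
open import Data.Product using (Σ; _×_; _,_; proj₁; proj₂)
open import Data.Sum using (_⊎_; inj₁; inj₂)
open import Data.Empty using (⊥-elim)
open import Function using (_∘_; flip)
open import Data.List.Relation.Unary.Linked using (Linked; []; _∷_)
open import Data.Vec.Relation.Unary.Linked using ([]; [-]; _∷_) renaming (Linked to VLinked)
open import Relation.Nullary using (Dec; yes; no)
open import Relation.Nullary.Decidable using (dec-true; dec-false)
open import Induction.WellFounded using (Acc; acc)
open import Data.Nat.Induction using (<-wellFounded)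
open import Relation.Binary.PropositionalEquality
open import Relation.Binary.Bundles using (Setoid)
open import Algebra.Properties.Group ℚP.+-0-group using (x∙y⁻¹≈ε⇒x≈y; x≈y⇒x∙y⁻¹≈ε)
open import Algebra.Properties.CommutativeSemigroup ℕP.+-commutativeSemigroup using (x∙yz≈y∙xz)
open import Data.Rational.Solver using (module +-*-Solver)
open +-*-Solver using (solve; _:+_; _:-_; :-_; _:=_)

-- Transpositions

module _ {n : ℕ} where

  transpose-left : (a b : Fin n) → transpose a b a ≡ b
  transpose-left a b rewrite dec-true (a Fin.≟ a) refl = refl

  transpose-right : (a b : Fin n) → transpose a b b ≡ a
  transpose-right a b with b Fin.≟ a
  ... | yes b≡a = b≡a
  ... | no b≢a rewrite dec-true (b Fin.≟ b) refl = refl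

  transpose-other : (a b k : Fin n) → k ≢ a → k ≢ b → transpose a b k ≡ k
  transpose-other a b k k≢a k≢b
    rewrite dec-false (k Fin.≟ a) k≢a | dec-false (k Fin.≟ b) k≢b = refl

  data TransposeCase (a b k : Fin n) : Set where
    at-left  : k ≡ a → TransposeCase a b k
    at-right : k ≡ b → TransposeCase a b k
    elsewhere : k ≢ a → k ≢ b → TransposeCase a b k

  transposeCase : (a b k : Fin n) → TransposeCase a b k
  transposeCase a b k with k Fin.≟ a | k Fin.≟ b
  ... | yes k≡a | _ = at-left k≡a
  ... | no _ | yes k≡b = at-right k≡b
  ... | no k≢a | no k≢b = elsewhere k≢a k≢b

  transpose-involutive : (a b k : Fin n) → transpose a b (transpose a b k) ≡ k
  transpose-involutive a b k with transposeCase a b k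
  ... | at-left refl = trans (cong (transpose k b) (transpose-left k b)) (transpose-right k b)
  ... | at-right refl = trans (cong (transpose a k) (transpose-right a k)) (transpose-left a k)
  ... | elsewhere k≢a k≢b =
    trans (cong (transpose a b) (transpose-other a b k k≢a k≢b)) (transpose-other a b k k≢a k≢b)

  transpose-injective : (a b : Fin n) {k l : Fin n} → transpose a b k ≡ transpose a b l → k ≡ l
  transpose-injective a b {k} {l} eq =
    trans (sym (transpose-involutive a b k))
          (trans (cong (transpose a b) eq) (transpose-involutive a b l))

transpose-natural : ∀ {n n′} (g : Fin n → Fin n′) → (∀ {k l} → g k ≡ g l → k ≡ l) →
  (a b k : Fin n) → transpose (g a) (g b) (g k) ≡ g (transpose a b k)
transpose-natural g g-inj a b k with transposeCase a b k
... | at-left refl = trans (transpose-left (g k) (g b)) (cong g (sym (transpose-left k b)))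
... | at-right refl = trans (transpose-right (g a) (g k)) (cong g (sym (transpose-right a k)))
... | elsewhere k≢a k≢b =
  trans (transpose-other (g a) (g b) (g k) (k≢a ∘ g-inj) (k≢b ∘ g-inj))
        (cong g (sym (transpose-other a b k k≢a k≢b)))

transpose-conjugate : ∀ {n} (c d a b k : Fin n) →
  transpose (transpose c d a) (transpose c d b) k ≡ transpose c d (transpose a b (transpose c d k))
transpose-conjugate c d a b k =
  trans (cong (transpose (transpose c d a) (transpose c d b)) (sym (transpose-involutive c d k)))
        (transpose-natural (transpose c d) (transpose-injective c d) a b (transpose c d k))

≡-fromLookup : ∀ {n} {u v : Vec ℕ n} → (∀ k → lookup u k ≡ lookup v k) → u ≡ v
≡-fromLookup {u = u} {v} eq =
  trans (sym (VecP.tabulate∘lookup u)) (trans (VecP.tabulate-cong eq) (VecP.tabulate∘lookup v))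

-- swapV i is swapAt (inject₁ i) (suc i) by definition.
swapAt : ∀ {n} → Fin n → Fin n → Vec ℕ n → Vec ℕ n
swapAt a b v = (v [ a ]≔ lookup v b) [ b ]≔ lookup v a

lookup-swapAt : ∀ {n} (a b : Fin n) (v : Vec ℕ n) k → lookup (swapAt a b v) k ≡ lookup v (transpose a b k)
lookup-swapAt a b v k with transposeCase a b k
... | at-right refl = trans (VecP.lookup∘updateAt k (v [ a ]≔ lookup v k)) (cong (lookup v) (sym (transpose-right a k)))
... | at-left refl with k Fin.≟ b
...   | yes refl = trans (VecP.lookup∘updateAt k (v [ k ]≔ lookup v k)) (cong (lookup v) (sym (transpose-right k k)))
...   | no k≢b = trans (VecP.lookup∘updateAt′ k b k≢b (v [ k ]≔ lookup v b))
                   (trans (VecP.lookup∘updateAt k v) (cong (lookup v) (sym (transpose-left k b))))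
lookup-swapAt a b v k | elsewhere k≢a k≢b =
  trans (VecP.lookup∘updateAt′ k b k≢b (v [ a ]≔ lookup v b))
        (trans (VecP.lookup∘updateAt′ k a k≢a v) (cong (lookup v) (sym (transpose-other a b k k≢a k≢b))))

module _ {n : ℕ} where

  lookup-swapAt-left : (a b : Fin n) (v : Vec ℕ n) → lookup (swapAt a b v) a ≡ lookup v b
  lookup-swapAt-left a b v = trans (lookup-swapAt a b v a) (cong (lookup v) (transpose-left a b))

  lookup-swapAt-right : (a b : Fin n) (v : Vec ℕ n) → lookup (swapAt a b v) b ≡ lookup v a
  lookup-swapAt-right a b v = trans (lookup-swapAt a b v b) (cong (lookup v) (transpose-right a b))

  lookup-swapAt-other : (a b k : Fin n) (v : Vec ℕ n) → k ≢ a → k ≢ b → lookup (swapAt a b v) k ≡ lookup v k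
  lookup-swapAt-other a b k v k≢a k≢b =
    trans (lookup-swapAt a b v k) (cong (lookup v) (transpose-other a b k k≢a k≢b))

  swapAt-involutive : (a b : Fin n) (v : Vec ℕ n) → swapAt a b (swapAt a b v) ≡ v
  swapAt-involutive a b v = ≡-fromLookup λ k →
    trans (lookup-swapAt a b (swapAt a b v) k) (trans (lookup-swapAt a b v _) (cong (lookup v) (transpose-involutive a b k)))

  swapAt-conjugate : (a b c d : Fin n) (v : Vec ℕ n) →
    swapAt c d (swapAt a b (swapAt c d v)) ≡ swapAt (transpose c d a) (transpose c d b) v
  swapAt-conjugate a b c d v = ≡-fromLookup λ k → begin
    lookup (swapAt c d (swapAt a b (swapAt c d v))) k
      ≡⟨ lookup-swapAt c d (swapAt a b (swapAt c d v)) k ⟩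
    lookup (swapAt a b (swapAt c d v)) (transpose c d k)
      ≡⟨ lookup-swapAt a b (swapAt c d v) _ ⟩
    lookup (swapAt c d v) (transpose a b (transpose c d k))
      ≡⟨ lookup-swapAt c d v _ ⟩
    lookup v (transpose c d (transpose a b (transpose c d k)))
      ≡⟨ cong (lookup v) (transpose-conjugate c d a b k) ⟨
    lookup v (transpose (transpose c d a) (transpose c d b) k)
      ≡⟨ lookup-swapAt _ _ v k ⟨
    lookup (swapAt (transpose c d a) (transpose c d b) v) k ∎
    where open ≡-Reasoning

  swapAt-of-equal : (a b : Fin n) (v : Vec ℕ n) → lookup v a ≡ lookup v b → swapAt a b v ≡ v
  swapAt-of-equal a b v eq = ≡-fromLookup λ k → trans (lookup-swapAt a b v k) (fixed k)
    where
    fixed : ∀ k → lookup v (transpose a b k) ≡ lookup v k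
    fixed k with transposeCase a b k
    ... | at-left refl = trans (cong (lookup v) (transpose-left k b)) (sym eq)
    ... | at-right refl = trans (cong (lookup v) (transpose-right a k)) eq
    ... | elsewhere k≢a k≢b = cong (lookup v) (transpose-other a b k k≢a k≢b)

  swapAt-updateAt : (a b c : Fin n) (f : ℕ → ℕ) (v : Vec ℕ n) →
    swapAt a b v [ c ]%= f ≡ swapAt a b (v [ transpose a b c ]%= f)
  swapAt-updateAt a b c f v = ≡-fromLookup λ k → lookups k (k Fin.≟ c)
    where
    lookups : ∀ k → Dec (k ≡ c) →
      lookup (swapAt a b v [ c ]%= f) k ≡ lookup (swapAt a b (v [ transpose a b c ]%= f)) k
    lookups k (yes refl) = begin
      lookup (swapAt a b v [ k ]%= f) k
        ≡⟨ VecP.lookup∘updateAt k (swapAt a b v) ⟩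
      f (lookup (swapAt a b v) k)
        ≡⟨ cong f (lookup-swapAt a b v k) ⟩
      f (lookup v (transpose a b k))
        ≡⟨ VecP.lookup∘updateAt (transpose a b k) v ⟨
      lookup (v [ transpose a b k ]%= f) (transpose a b k)
        ≡⟨ lookup-swapAt a b (v [ transpose a b k ]%= f) k ⟨
      lookup (swapAt a b (v [ transpose a b k ]%= f)) k ∎
      where open ≡-Reasoning
    lookups k (no k≢c) = begin
      lookup (swapAt a b v [ c ]%= f) k
        ≡⟨ VecP.lookup∘updateAt′ k c k≢c (swapAt a b v) ⟩
      lookup (swapAt a b v) k
        ≡⟨ lookup-swapAt a b v k ⟩
      lookup v (transpose a b k)
        ≡⟨ VecP.lookup∘updateAt′ _ _ (k≢c ∘ transpose-injective a b) v ⟨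
      lookup (v [ transpose a b c ]%= f) (transpose a b k)
        ≡⟨ lookup-swapAt a b (v [ transpose a b c ]%= f) k ⟨
      lookup (swapAt a b (v [ transpose a b c ]%= f)) k ∎
      where open ≡-Reasoning

insertAt-updateAt : ∀ {n} (v : Vec ℕ n) (p : Fin (suc n)) (j : Fin n) (f : ℕ → ℕ) x →
  insertAt (v [ j ]%= f) p x ≡ insertAt v p x [ punchIn p j ]%= f
insertAt-updateAt v zero j f x = refl
insertAt-updateAt (y ∷ v) (suc p) zero f x = refl
insertAt-updateAt (y ∷ v) (suc p) (suc j) f x = cong (y ∷_) (insertAt-updateAt v p j f x)

insertAt-swapAt : ∀ {n} (v : Vec ℕ n) (p : Fin (suc n)) (a b : Fin n) x →
  insertAt (swapAt a b v) p x ≡ swapAt (punchIn p a) (punchIn p b) (insertAt v p x)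
insertAt-swapAt v p a b x = begin
  insertAt ((v [ a ]≔ lookup v b) [ b ]≔ lookup v a) p x
    ≡⟨ insertAt-updateAt _ p b _ x ⟩
  insertAt (v [ a ]≔ lookup v b) p x [ punchIn p b ]≔ lookup v a
    ≡⟨ cong (_[ punchIn p b ]≔ lookup v a) (insertAt-updateAt v p a _ x) ⟩
  (w [ punchIn p a ]≔ lookup v b) [ punchIn p b ]≔ lookup v a
    ≡⟨ cong₂ (λ y z → (w [ punchIn p a ]≔ y) [ punchIn p b ]≔ z)
             (sym (VecP.insertAt-punchIn v p x b)) (sym (VecP.insertAt-punchIn v p x a)) ⟩
  swapAt (punchIn p a) (punchIn p b) w ∎
  where
  open ≡-Reasoning
  w = insertAt v p x

removeAt-swapAt : ∀ {n} (v : Vec ℕ (suc n)) (p : Fin (suc n)) (a b : Fin n) →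
  removeAt (swapAt (punchIn p a) (punchIn p b) v) p ≡ swapAt a b (removeAt v p)
removeAt-swapAt v p a b = begin
  removeAt (swapAt (punchIn p a) (punchIn p b) v) p
    ≡⟨ cong (λ w → removeAt (swapAt (punchIn p a) (punchIn p b) w) p) (VecP.insertAt-removeAt v p) ⟨
  removeAt (swapAt (punchIn p a) (punchIn p b) (insertAt (removeAt v p) p (lookup v p))) p
    ≡⟨ cong (λ w → removeAt w p) (insertAt-swapAt (removeAt v p) p a b _) ⟨
  removeAt (insertAt (swapAt a b (removeAt v p)) p (lookup v p)) p
    ≡⟨ VecP.removeAt-insertAt _ p _ ⟩
  swapAt a b (removeAt v p) ∎
  where open ≡-Reasoning

lookup-removeAt : ∀ {n} (v : Vec ℕ (suc n)) (p : Fin (suc n)) (k : Fin n) →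
  lookup (removeAt v p) k ≡ lookup v (punchIn p k)
lookup-removeAt v p k = begin
  lookup (removeAt v p) k
    ≡⟨ VecP.insertAt-punchIn _ p _ k ⟨
  lookup (insertAt (removeAt v p) p (lookup v p)) (punchIn p k)
    ≡⟨ cong (λ w → lookup w (punchIn p k)) (VecP.insertAt-removeAt v p) ⟩
  lookup v (punchIn p k) ∎
  where open ≡-Reasoning

insertAt-suc : ∀ {n} (v : Vec ℕ n) (i : Fin n) x →
  insertAt v (suc i) x ≡ swapAt (inject₁ i) (suc i) (insertAt v (inject₁ i) x)
insertAt-suc (y ∷ v) zero x = refl
insertAt-suc (y ∷ v) (suc i) x = cong (y ∷_) (insertAt-suc v i x)

removeAt-swapV : ∀ {n} (i : Fin n) (v : Vec ℕ (suc n)) → removeAt (swapV i v) (suc i) ≡ removeAt v (inject₁ i)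
removeAt-swapV zero (x ∷ y ∷ v) = refl
removeAt-swapV (suc zero) (x ∷ y ∷ z ∷ v) = refl
removeAt-swapV (suc (suc i)) (x ∷ y ∷ v) = cong (x ∷_) (removeAt-swapV (suc i) (y ∷ v))

-- A polynomial is handled through its coefficient function; X a, Δ a b, Sw a b
-- and setZero p act on coefficients as multiplication by x_a and by x_a - x_b,
-- exchange of x_a and x_b, and the substitution x_p = 0.

Coeffs : ℕ → Set
Coeffs n = Vec ℕ n → ℚ

module ≗ {A B : Set} = Setoid (A →-setoid B)

infixl 6 _⊟_
_⊟_ : ∀ {n} → Coeffs n → Coeffs n → Coeffs n
(f ⊟ g) m = f m - g m

ifPositive : ℕ → ℚ → ℚ
ifPositive zero _ = 0ℚ
ifPositive (suc _) q = q

X : ∀ {n} → Fin n → Coeffs n → Coeffs n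
X a f m = ifPositive (lookup m a) (f (m [ a ]%= pred))

Δ : ∀ {n} → Fin n → Fin n → Coeffs n → Coeffs n
Δ a b f = X a f ⊟ X b f

Sw : ∀ {n} → Fin n → Fin n → Coeffs n → Coeffs n
Sw a b f = f ∘ swapAt a b

setZero : ∀ {n} → Fin (suc n) → Coeffs (suc n) → Coeffs n
setZero p f m = f (insertAt m p 0)

indicator : ∀ {n} → Vec ℕ n → Coeffs n
indicator α m with VecP.≡-dec _≟_ α m
... | yes _ = 1ℚ
... | no _ = 0ℚ

coeff-++ : ∀ {n} (p q : Poly n) m → coeff (p List.++ q) m ≡ coeff p m + coeff q m
coeff-++ [] q m = sym (ℚP.+-identityˡ _)
coeff-++ ((c , e) ∷ p) q m with VecP.≡-dec _≟_ e m
... | yes _ = trans (cong (c +_) (coeff-++ p q m)) (sym (ℚP.+-assoc c _ _))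
... | no _ = coeff-++ p q m

coeff-neg : ∀ {n} (p : Poly n) m → coeff (neg p) m ≡ - coeff p m
coeff-neg [] m = refl
coeff-neg ((c , e) ∷ p) m with VecP.≡-dec _≟_ e m
... | yes _ = trans (cong (- c +_) (coeff-neg p m)) (sym (ℚP.neg-distrib-+ c _))
... | no _ = coeff-neg p m

coeff-⊖ : ∀ {n} (p q : Poly n) m → coeff (p ⊖ q) m ≡ coeff p m - coeff q m
coeff-⊖ p q m = trans (coeff-++ p (neg q) m) (cong (coeff p m +_) (coeff-neg q m))

module _ {n n′} (g : Vec ℕ n → Vec ℕ n′) where

  mapExponents : Poly n → Poly n′
  mapExponents = map (λ t → proj₁ t , g (proj₂ t))

  coeff-mapExponents : ∀ m′ m → (∀ e → g e ≡ m → e ≡ m′) → g m′ ≡ m →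
    ∀ p → coeff (mapExponents p) m ≡ coeff p m′
  coeff-mapExponents m′ m fibre image [] = refl
  coeff-mapExponents m′ m fibre image ((c , e) ∷ p) with VecP.≡-dec _≟_ (g e) m | VecP.≡-dec _≟_ e m′
  ... | yes _ | yes _ = cong (c +_) (coeff-mapExponents m′ m fibre image p)
  ... | yes ge≡m | no e≢m′ = ⊥-elim (e≢m′ (fibre e ge≡m))
  ... | no ge≢m | yes refl = ⊥-elim (ge≢m image)
  ... | no _ | no _ = coeff-mapExponents m′ m fibre image p

  coeff-mapExponents-outside : ∀ m → (∀ e → g e ≢ m) → ∀ p → coeff (mapExponents p) m ≡ 0ℚ
  coeff-mapExponents-outside m outside [] = refl
  coeff-mapExponents-outside m outside ((c , e) ∷ p) with VecP.≡-dec _≟_ (g e) m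
  ... | yes ge≡m = ⊥-elim (outside e ge≡m)
  ... | no _ = coeff-mapExponents-outside m outside p

  coeff-mapExponents-filter : (P : Vec ℕ n → ℕ) → ∀ m′ m →
    (∀ e → P e ≡ 0 → g e ≡ m → e ≡ m′) → P m′ ≡ 0 → g m′ ≡ m →
    ∀ p → coeff (mapExponents (filter (λ t → P (proj₂ t) ≟ 0) p)) m ≡ coeff p m′
  coeff-mapExponents-filter P m′ m fibre P0 image [] = refl
  coeff-mapExponents-filter P m′ m fibre P0 image ((c , e) ∷ p) with P e in Pe
  ... | zero with VecP.≡-dec _≟_ (g e) m | VecP.≡-dec _≟_ e m′
  ...   | yes _ | yes _ = cong (c +_) (coeff-mapExponents-filter P m′ m fibre P0 image p)
  ...   | yes ge≡m | no e≢m′ = ⊥-elim (e≢m′ (fibre e Pe ge≡m))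
  ...   | no ge≢m | yes refl = ⊥-elim (ge≢m image)
  ...   | no _ | no _ = coeff-mapExponents-filter P m′ m fibre P0 image p
  coeff-mapExponents-filter P m′ m fibre P0 image ((c , e) ∷ p) | suc _ with VecP.≡-dec _≟_ e m′
  ...   | yes refl = ⊥-elim (ℕP.1+n≢0 (trans (sym Pe) P0))
  ...   | no _ = coeff-mapExponents-filter P m′ m fibre P0 image p

coeff-mulX : ∀ {n} (j : Fin n) (p : Poly n) → coeff (mulX j p) ≗ X j (coeff p)
coeff-mulX j p m with lookup m j in mj
... | zero = coeff-mapExponents-outside (_[ j ]%= suc) m
               (λ e eq → ℕP.1+n≢0 (trans (sym (VecP.lookup∘updateAt j e))
                                         (trans (cong (λ v → lookup v j) eq) mj))) p
... | suc k = coeff-mapExponents (_[ j ]%= suc) (m [ j ]%= pred) m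
               (λ e eq → trans (sym (pred-suc e)) (cong (_[ j ]%= pred) eq))
               (trans (VecP.updateAt-updateAt j m)
                      (VecP.updateAt-id-local j m (trans (cong (λ x → ℕ.suc (pred x)) mj) (sym mj)))) p
  where
  pred-suc : ∀ e → (e [ j ]%= suc) [ j ]%= pred ≡ e
  pred-suc e = trans (VecP.updateAt-updateAt j e) (VecP.updateAt-id j e)

coeff-σ : ∀ {n} (i : Fin n) (p : Poly (suc n)) → coeff (σ i p) ≗ Sw (inject₁ i) (suc i) (coeff p)
coeff-σ i p m = coeff-mapExponents (swapV i) (swapV i m) m
  (λ e eq → trans (sym (swapAt-involutive (inject₁ i) (suc i) e)) (cong (swapV i) eq))
  (swapAt-involutive (inject₁ i) (suc i) m) p

coeff-monomial : ∀ {n} (α : Vec ℕ n) → coeff (monomial α) ≗ indicator α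
coeff-monomial α m with VecP.≡-dec _≟_ α m
... | yes _ = ℚP.+-identityʳ 1ℚ
... | no _ = refl

module _ {n : ℕ} where

  X-⊟ : (a : Fin n) (f g : Coeffs n) → X a (f ⊟ g) ≗ X a f ⊟ X a g
  X-⊟ a f g m with lookup m a
  ... | zero = refl
  ... | suc _ = refl

  X-cong : (a : Fin n) {f g : Coeffs n} → f ≗ g → X a f ≗ X a g
  X-cong a f≗g m = cong (ifPositive (lookup m a)) (f≗g _)

  X-⊟-cong : (a b : Fin n) {f f′ g g′ : Coeffs n} → f ≗ f′ → g ≗ g′ →
    X a f ⊟ X b g ≗ X a f′ ⊟ X b g′
  X-⊟-cong a b f≗f′ g≗g′ m = cong₂ _-_ (X-cong a f≗f′ m) (X-cong b g≗g′ m)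

  X-X : (a b : Fin n) (f : Coeffs n) → X a (X b f) ≗ X b (X a f)
  X-X a b f m with a Fin.≟ b
  ... | yes refl = refl
  ... | no a≢b = begin
    ifPositive (lookup m a) (ifPositive (lookup (m [ a ]%= pred) b) (f ((m [ a ]%= pred) [ b ]%= pred)))
      ≡⟨ cong (λ x → ifPositive (lookup m a) (ifPositive x (f ((m [ a ]%= pred) [ b ]%= pred))))
              (VecP.lookup∘updateAt′ b a (a≢b ∘ sym) m) ⟩
    ifPositive (lookup m a) (ifPositive (lookup m b) (f ((m [ a ]%= pred) [ b ]%= pred)))
      ≡⟨ ifPositive-comm (lookup m a) (lookup m b) _ ⟩
    ifPositive (lookup m b) (ifPositive (lookup m a) (f ((m [ a ]%= pred) [ b ]%= pred)))
      ≡⟨ cong (λ v → ifPositive (lookup m b) (ifPositive (lookup m a) (f v))) (VecP.updateAt-commutes a b a≢b m) ⟨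
    ifPositive (lookup m b) (ifPositive (lookup m a) (f ((m [ b ]%= pred) [ a ]%= pred)))
      ≡⟨ cong (λ x → ifPositive (lookup m b) (ifPositive x (f ((m [ b ]%= pred) [ a ]%= pred))))
              (VecP.lookup∘updateAt′ a b a≢b m) ⟨
    ifPositive (lookup m b) (ifPositive (lookup (m [ b ]%= pred) a) (f ((m [ b ]%= pred) [ a ]%= pred))) ∎
    where
    open ≡-Reasoning
    ifPositive-comm : ∀ x y q → ifPositive x (ifPositive y q) ≡ ifPositive y (ifPositive x q)
    ifPositive-comm zero zero q = refl
    ifPositive-comm zero (suc y) q = refl
    ifPositive-comm (suc x) zero q = refl
    ifPositive-comm (suc x) (suc y) q = refl

  Sw-X : (a b c : Fin n) (f : Coeffs n) → Sw a b (X c f) ≗ X (transpose a b c) (Sw a b f)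
  Sw-X a b c f m = cong₂ ifPositive (lookup-swapAt a b m c) (cong f (swapAt-updateAt a b c pred m))

  Sw-involutive : (a b : Fin n) (f : Coeffs n) → Sw a b (Sw a b f) ≗ f
  Sw-involutive a b f m = cong f (swapAt-involutive a b m)

  X-suc : (a : Fin n) (f : Coeffs n) (m : Vec ℕ n) → X a f (m [ a ]%= suc) ≡ f m
  X-suc a f m = cong₂ ifPositive (VecP.lookup∘updateAt a m) (cong f pred-suc)
    where
    pred-suc : (m [ a ]%= suc) [ a ]%= pred ≡ m
    pred-suc = trans (VecP.updateAt-updateAt a m) (VecP.updateAt-id a m)

module _ {n : ℕ} (p : Fin (suc n)) where

  setZero-X : (j : Fin n) (f : Coeffs (suc n)) → setZero p (X (punchIn p j) f) ≗ X j (setZero p f)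
  setZero-X j f m = cong₂ ifPositive (VecP.insertAt-punchIn m p 0 j) (cong f (sym (insertAt-updateAt m p j pred 0)))

  setZero-X-self : (f : Coeffs (suc n)) (m : Vec ℕ n) → setZero p (X p f) m ≡ 0ℚ
  setZero-X-self f m rewrite VecP.insertAt-lookup m p 0 = refl

  setZero-Sw : (a b : Fin n) (f : Coeffs (suc n)) → setZero p (Sw (punchIn p a) (punchIn p b) f) ≗ Sw a b (setZero p f)
  setZero-Sw a b f m = cong f (sym (insertAt-swapAt m p a b 0))

setZero-suc : ∀ {n} (i : Fin n) (f : Coeffs (suc n)) →
  setZero (suc i) f ≗ setZero (inject₁ i) (Sw (inject₁ i) (suc i) f)
setZero-suc i f m = cong f (insertAt-suc m i 0)

minus-interchange : ∀ p q r s → (p - q) - (r - s) ≡ (p - r) - (q - s)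
minus-interchange = solve 4 (λ p q r s → (p :- q) :- (r :- s) := (p :- r) :- (q :- s)) refl

module _ {n : ℕ} where

  cancel-X : (a : Fin n) {f g : Coeffs n} → X a f ≗ X a g → f ≗ g
  cancel-X a {f} {g} eq m = trans (sym (X-suc a f m)) (trans (eq (m [ a ]%= suc)) (X-suc a g m))

  -- Writing m⁺ = m + e_a, the coefficient of (x_a - x_b) h at m⁺ is h m - h (m⁺ - e_b),
  -- so a vanishing product forces h to vanish by induction on the b-exponent.
  cancel-Δ-zero : (a b : Fin n) → a ≢ b → (h : Coeffs n) →
    (∀ m → Δ a b h m ≡ 0ℚ) → ∀ m → h m ≡ 0ℚ
  cancel-Δ-zero a b a≢b h H m = go (lookup m b) m refl
    where
    go : ∀ t m → lookup m b ≡ t → h m ≡ 0ℚ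
    go t m mb = step t mb
      where
      m⁺ = m [ a ]%= suc
      h′ = h (m⁺ [ b ]%= pred)
      m⁺b : lookup m⁺ b ≡ lookup m b
      m⁺b = VecP.lookup∘updateAt′ b a (a≢b ∘ sym) m
      H′ : h m - ifPositive (lookup m b) h′ ≡ 0ℚ
      H′ = trans (cong₂ _-_ (sym (X-suc a h m)) (cong (λ x → ifPositive x h′) (sym m⁺b))) (H m⁺)
      step : ∀ t → lookup m b ≡ t → h m ≡ 0ℚ
      step zero mb≡0 = trans (sym (ℚP.+-identityʳ (h m))) (trans (cong (λ x → h m - ifPositive x h′) (sym mb≡0)) H′)
      step (suc t) mb≡1+t = trans
        (x∙y⁻¹≈ε⇒x≈y _ _ (trans (cong (λ x → h m - ifPositive x h′) (sym mb≡1+t)) H′))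
        (go t (m⁺ [ b ]%= pred) (trans (VecP.lookup∘updateAt b m⁺) (cong pred (trans m⁺b mb≡1+t))))

  cancel-Δ : (a b : Fin n) → a ≢ b → {f g : Coeffs n} → Δ a b f ≗ Δ a b g → f ≗ g
  cancel-Δ a b a≢b {f} {g} eq m = x∙y⁻¹≈ε⇒x≈y _ _ (cancel-Δ-zero a b a≢b (f ⊟ g) product-zero m)
    where
    product-zero : ∀ m → Δ a b (f ⊟ g) m ≡ 0ℚ
    product-zero m = begin
      X a (f ⊟ g) m - X b (f ⊟ g) m
        ≡⟨ cong₂ _-_ (X-⊟ a f g m) (X-⊟ b f g m) ⟩
      (X a f m - X a g m) - (X b f m - X b g m)
        ≡⟨ minus-interchange (X a f m) (X a g m) (X b f m) (X b g m) ⟩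
      (X a f m - X b f m) - (X a g m - X b g m)
        ≡⟨ x≈y⇒x∙y⁻¹≈ε (eq m) ⟩
      0ℚ ∎
      where open ≡-Reasoning

-- Demazure operators

-- G = ξ_{ab} F for the Demazure operator ξ_{ab} F = (x_a F - x_b s_{ab} F) / (x_a - x_b),
-- with the division cleared.
IsDemazure : ∀ {n} → Fin n → Fin n → Coeffs n → Coeffs n → Set
IsDemazure a b F G = Δ a b G ≗ X a F ⊟ X b (Sw a b F)

module _ {n : ℕ} where

  Sw-X⊟X : (a b : Fin n) {c d e g c′ d′ e′ g′ : Fin n} (Y P Q : Coeffs n) →
    transpose a b c ≡ c′ → transpose a b d ≡ d′ → transpose a b e ≡ e′ → transpose a b g ≡ g′ →
    X c Y ⊟ X d Y ≗ X e P ⊟ X g Q →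
    X c′ (Sw a b Y) ⊟ X d′ (Sw a b Y) ≗ X e′ (Sw a b P) ⊟ X g′ (Sw a b Q)
  Sw-X⊟X a b {c} {d} {e} {g} Y P Q refl refl refl refl eq m =
    trans (sym (cong₂ _-_ (Sw-X a b c Y m) (Sw-X a b d Y m)))
          (trans (eq (swapAt a b m)) (cong₂ _-_ (Sw-X a b e P m) (Sw-X a b g Q m)))

  demazure-symmetric : (a b : Fin n) → a ≢ b → (F G : Coeffs n) → IsDemazure a b F G → Sw a b G ≗ G
  demazure-symmetric a b a≢b F G G≡ξF = cancel-Δ a b a≢b λ m → begin
    X a SG m - X b SG m             ≡⟨ ⁻-swap (X b SG m) (X a SG m) ⟩
    - (X b SG m - X a SG m)         ≡⟨ cong -_ (swapped m) ⟩
    - (X b SF m - X a SSF m)        ≡⟨ ⁻-swap (X b SF m) (X a SSF m) ⟨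
    X a SSF m - X b SF m            ≡⟨ cong (_- X b SF m) (X-cong a (Sw-involutive a b F) m) ⟩
    X a F m - X b SF m              ≡⟨ G≡ξF m ⟨
    X a G m - X b G m               ∎
    where
    open ≡-Reasoning
    SG = Sw a b G
    SF = Sw a b F
    SSF = Sw a b SF
    swapped : X b SG ⊟ X a SG ≗ X b SF ⊟ X a SSF
    swapped = Sw-X⊟X a b G F SF (transpose-left a b) (transpose-right a b)
                                 (transpose-left a b) (transpose-right a b) G≡ξF
    ⁻-swap : ∀ x y → y - x ≡ - (x - y)
    ⁻-swap = solve 2 (λ x y → y :- x := :- (x :- y)) refl

  demazure-Sw-disjoint : (a b c d : Fin n) → a ≢ b → a ≢ c → a ≢ d → b ≢ c → b ≢ d →
    (F G : Coeffs n) → IsDemazure a b F G → Sw c d F ≗ F → Sw c d G ≗ G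
  demazure-Sw-disjoint a b c d a≢b a≢c a≢d b≢c b≢d F G G≡ξF F-sym = cancel-Δ a b a≢b
    (≗.trans swapped (≗.trans (X-⊟-cong a b F-sym commute) (≗.sym G≡ξF)))
    where
    fixes : ∀ {k} → k ≢ c → k ≢ d → transpose c d k ≡ k
    fixes = transpose-other c d _
    swapped : X a (Sw c d G) ⊟ X b (Sw c d G) ≗ X a (Sw c d F) ⊟ X b (Sw c d (Sw a b F))
    swapped = Sw-X⊟X c d G F (Sw a b F) (fixes a≢c a≢d) (fixes b≢c b≢d)
                                         (fixes a≢c a≢d) (fixes b≢c b≢d) G≡ξF
    commute : Sw c d (Sw a b F) ≗ Sw a b F
    commute m = begin
      F (swapAt a b (swapAt c d m))
        ≡⟨ F-sym _ ⟨
      F (swapAt c d (swapAt a b (swapAt c d m)))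
        ≡⟨ cong F (swapAt-conjugate a b c d m) ⟩
      F (swapAt (transpose c d a) (transpose c d b) m)
        ≡⟨ cong₂ (λ x y → F (swapAt x y m)) (fixes a≢c a≢d) (fixes b≢c b≢d) ⟩
      F (swapAt a b m) ∎
      where open ≡-Reasoning

  demazure-unique : (a b : Fin n) → a ≢ b → {F F′ G G′ : Coeffs n} →
    IsDemazure a b F G → IsDemazure a b F′ G′ → F ≗ F′ → G ≗ G′
  demazure-unique a b a≢b G≡ξF G′≡ξF′ F≗F′ =
    cancel-Δ a b a≢b (≗.trans G≡ξF (≗.trans (X-⊟-cong a b F≗F′ (F≗F′ ∘ swapAt a b)) (≗.sym G′≡ξF′)))

  setZero-demazure : (p : Fin (suc n)) (a b : Fin n) (F G : Coeffs (suc n)) →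
    IsDemazure (punchIn p a) (punchIn p b) F G → IsDemazure a b (setZero p F) (setZero p G)
  setZero-demazure p a b F G G≡ξF m = begin
    X a (setZero p G) m - X b (setZero p G) m
      ≡⟨ cong₂ _-_ (setZero-X p a G m) (setZero-X p b G m) ⟨
    X (punchIn p a) G (insertAt m p 0) - X (punchIn p b) G (insertAt m p 0)
      ≡⟨ G≡ξF (insertAt m p 0) ⟩
    X (punchIn p a) F (insertAt m p 0) - X (punchIn p b) (Sw (punchIn p a) (punchIn p b) F) (insertAt m p 0)
      ≡⟨ cong₂ _-_ (setZero-X p a F m)
                   (trans (setZero-X p b (Sw (punchIn p a) (punchIn p b) F) m) (X-cong b (setZero-Sw p a b F) m)) ⟩
    X a (setZero p F) m - X b (Sw a b (setZero p F)) m ∎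
    where open ≡-Reasoning

  Δ-Δ : (a b c d : Fin n) (Y : Coeffs n) → Δ a d (Δ b c Y) ≗ Δ b c (Δ a d Y)
  Δ-Δ a b c d Y m = begin
    X a (Δ b c Y) m - X d (Δ b c Y) m
      ≡⟨ cong₂ _-_ (X-⊟ a (X b Y) (X c Y) m) (X-⊟ d (X b Y) (X c Y) m) ⟩
    (X a (X b Y) m - X a (X c Y) m) - (X d (X b Y) m - X d (X c Y) m)
      ≡⟨ cong₂ _-_ (cong₂ _-_ (X-X a b Y m) (X-X a c Y m)) (cong₂ _-_ (X-X d b Y m) (X-X d c Y m)) ⟩
    (X b (X a Y) m - X c (X a Y) m) - (X b (X d Y) m - X c (X d Y) m)
      ≡⟨ minus-interchange (X b (X a Y) m) (X c (X a Y) m) (X b (X d Y) m) (X c (X d Y) m) ⟩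
    (X b (X a Y) m - X b (X d Y) m) - (X c (X a Y) m - X c (X d Y) m)
      ≡⟨ cong₂ _-_ (X-⊟ b (X a Y) (X d Y) m) (X-⊟ c (X a Y) (X d Y) m) ⟨
    X b (Δ a d Y) m - X c (Δ a d Y) m ∎
    where open ≡-Reasoning

  X-cong-⊟ : (c a b : Fin n) (G P Q : Coeffs n) → Δ a b G ≗ X a P ⊟ X b Q →
    ∀ m → X c (X a G) m - X c (X b G) m ≡ X c (X a P) m - X c (X b Q) m
  X-cong-⊟ c a b G P Q eq m =
    trans (sym (X-⊟ c (X a G) (X b G) m)) (trans (X-cong c eq m) (X-⊟ c (X a P) (X b Q) m))

braid-arithmetic : ∀ u a₂ a₃ a₄ b₂ b₃ b₄ c₁ c₂ c₃ →
  b₃ - a₃ ≡ c₁ - c₂ → a₂ - a₄ ≡ c₁ - c₃ → b₂ - b₄ ≡ c₂ - c₃ →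
  (u - a₂) - (a₃ - a₄) ≡ (u - b₂) - (b₃ - b₄)
braid-arithmetic u a₂ a₃ a₄ b₂ b₃ b₄ c₁ c₂ c₃ eq₁ eq₂ eq₃ = begin
  (u - a₂) - (a₃ - a₄)
    ≡⟨ solve 7 (λ u a₂ a₃ a₄ b₂ b₃ b₄ → (u :- a₂) :- (a₃ :- a₄) :=
                  ((u :- b₂) :- (b₃ :- b₄)) :+ (((b₃ :- a₃) :- (a₂ :- a₄)) :+ (b₂ :- b₄)))
             refl u a₂ a₃ a₄ b₂ b₃ b₄ ⟩
  ((u - b₂) - (b₃ - b₄)) + (((b₃ - a₃) - (a₂ - a₄)) + (b₂ - b₄))
    ≡⟨ cong (((u - b₂) - (b₃ - b₄)) +_) (cong₂ _+_ (cong₂ _-_ eq₁ eq₂) eq₃) ⟩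
  ((u - b₂) - (b₃ - b₄)) + (((c₁ - c₂) - (c₁ - c₃)) + (c₂ - c₃))
    ≡⟨ solve 4 (λ v c₁ c₂ c₃ → v :+ (((c₁ :- c₂) :- (c₁ :- c₃)) :+ (c₂ :- c₃)) := v)
             refl ((u - b₂) - (b₃ - b₄)) c₁ c₂ c₃ ⟩
  (u - b₂) - (b₃ - b₄) ∎
  where open ≡-Reasoning

module Braid {n : ℕ} (p₁ p₂ p₃ : Fin n)
             (p₁≢p₂ : p₁ ≢ p₂) (p₂≢p₃ : p₂ ≢ p₃) (p₁≢p₃ : p₁ ≢ p₃) where
  private
    τ₁₂p₁ : transpose p₁ p₂ p₁ ≡ p₂
    τ₁₂p₁ = transpose-left p₁ p₂
    τ₁₂p₂ : transpose p₁ p₂ p₂ ≡ p₁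
    τ₁₂p₂ = transpose-right p₁ p₂
    τ₁₂p₃ : transpose p₁ p₂ p₃ ≡ p₃
    τ₁₂p₃ = transpose-other p₁ p₂ p₃ (p₁≢p₃ ∘ sym) (p₂≢p₃ ∘ sym)
    τ₂₃p₁ : transpose p₂ p₃ p₁ ≡ p₁
    τ₂₃p₁ = transpose-other p₂ p₃ p₁ p₁≢p₂ p₁≢p₃
    τ₂₃p₂ : transpose p₂ p₃ p₂ ≡ p₃
    τ₂₃p₂ = transpose-left p₂ p₃
    τ₂₃p₃ : transpose p₂ p₃ p₃ ≡ p₂
    τ₂₃p₃ = transpose-right p₂ p₃

  Sw-braid : (F : Coeffs n) → Sw p₂ p₃ (Sw p₁ p₂ (Sw p₂ p₃ F)) ≗ Sw p₁ p₂ (Sw p₂ p₃ (Sw p₁ p₂ F))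
  Sw-braid F m = cong F (begin
    swapAt p₂ p₃ (swapAt p₁ p₂ (swapAt p₂ p₃ m))                ≡⟨ swapAt-conjugate p₁ p₂ p₂ p₃ m ⟩
    swapAt (transpose p₂ p₃ p₁) (transpose p₂ p₃ p₂) m        ≡⟨ cong₂ (λ a b → swapAt a b m) τ₂₃p₁ τ₂₃p₂ ⟩
    swapAt p₁ p₃ m                                            ≡⟨ cong₂ (λ a b → swapAt a b m) τ₁₂p₂ τ₁₂p₃ ⟨
    swapAt (transpose p₁ p₂ p₂) (transpose p₁ p₂ p₃) m        ≡⟨ swapAt-conjugate p₂ p₃ p₁ p₂ m ⟨
    swapAt p₁ p₂ (swapAt p₂ p₃ (swapAt p₁ p₂ m))                ∎)
    where open ≡-Reasoning

  -- Both proofs compare (x₁ - x₃)(x₁ - x₂) H, resp. (x₁ - x₃)(x₂ - x₃) H, with the same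
  -- product applied to the swapped H and expand both sides through the three Demazure
  -- relations obtained from the hypotheses by swapping variables.
  demazure-braid₁ : (F G H : Coeffs n) → Sw p₁ p₂ F ≗ F →
    IsDemazure p₂ p₃ F G → IsDemazure p₁ p₂ G H → Sw p₂ p₃ H ≗ H
  demazure-braid₁ F G H F-sym G≡ξF H≡ξG =
    ≗.sym (cancel-Δ p₁ p₂ p₁≢p₂ (cancel-Δ p₁ p₃ p₁≢p₃ expanded))
    where
    S₁₂G = Sw p₁ p₂ G
    S₂₃F = Sw p₂ p₃ F
    T = Sw p₂ p₃ S₁₂G
    W = Sw p₁ p₂ S₂₃F
    SH = Sw p₂ p₃ H
    G-sym : Sw p₂ p₃ G ≗ G
    G-sym = demazure-symmetric p₂ p₃ p₂≢p₃ F G G≡ξF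
    W-sym : Sw p₂ p₃ W ≗ W
    W-sym m = trans (Sw-braid F m) (F-sym (swapAt p₂ p₃ (swapAt p₁ p₂ m)))
    SH-rel : Δ p₁ p₃ SH ≗ X p₁ G ⊟ X p₃ T
    SH-rel m = trans (Sw-X⊟X p₂ p₃ H G S₁₂G τ₂₃p₁ τ₂₃p₂ τ₂₃p₁ τ₂₃p₂ H≡ξG m)
                     (cong (_- X p₃ T m) (X-cong p₁ G-sym m))
    S₁₂G-rel : Δ p₁ p₃ S₁₂G ≗ X p₁ F ⊟ X p₃ W
    S₁₂G-rel m = trans (Sw-X⊟X p₁ p₂ G F S₂₃F τ₁₂p₂ τ₁₂p₃ τ₁₂p₂ τ₁₂p₃ G≡ξF m)
                       (cong (_- X p₃ W m) (X-cong p₁ F-sym m))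
    T-rel : Δ p₁ p₂ T ≗ X p₁ S₂₃F ⊟ X p₂ W
    T-rel m = trans (Sw-X⊟X p₂ p₃ S₁₂G F W τ₂₃p₁ τ₂₃p₃ τ₂₃p₁ τ₂₃p₃ S₁₂G-rel m)
                    (cong (λ x → X p₁ S₂₃F m - x) (X-cong p₂ W-sym m))
    expanded : Δ p₁ p₃ (Δ p₁ p₂ H) ≗ Δ p₁ p₃ (Δ p₁ p₂ SH)
    expanded m = begin
      Δ p₁ p₃ (Δ p₁ p₂ H) m
        ≡⟨ cong₂ _-_ (X-cong p₁ H≡ξG m) (X-cong p₃ H≡ξG m) ⟩
      Δ p₁ p₃ (X p₁ G ⊟ X p₂ S₁₂G) m
        ≡⟨ cong₂ _-_ (X-⊟ p₁ (X p₁ G) (X p₂ S₁₂G) m) (X-⊟ p₃ (X p₁ G) (X p₂ S₁₂G) m) ⟩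
      (u - a₂) - (a₃ - a₄)
        ≡⟨ braid-arithmetic u a₂ a₃ a₄ b₂ b₃ b₄ c₁ c₂ c₃ eq₁ eq₂ eq₃ ⟩
      (u - b₂) - (b₃ - b₄)
        ≡⟨ cong₂ _-_ (X-⊟ p₁ (X p₁ G) (X p₃ T) m) (X-⊟ p₂ (X p₁ G) (X p₃ T) m) ⟨
      Δ p₁ p₂ (X p₁ G ⊟ X p₃ T) m
        ≡⟨ cong₂ _-_ (X-cong p₁ SH-rel m) (X-cong p₂ SH-rel m) ⟨
      Δ p₁ p₂ (Δ p₁ p₃ SH) m
        ≡⟨ Δ-Δ p₁ p₁ p₂ p₃ SH m ⟨
      Δ p₁ p₃ (Δ p₁ p₂ SH) m ∎
      where
      open ≡-Reasoning
      u = X p₁ (X p₁ G) m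
      a₂ = X p₁ (X p₂ S₁₂G) m
      a₃ = X p₃ (X p₁ G) m
      a₄ = X p₃ (X p₂ S₁₂G) m
      b₂ = X p₁ (X p₃ T) m
      b₃ = X p₂ (X p₁ G) m
      b₄ = X p₂ (X p₃ T) m
      c₁ = X p₁ (X p₂ F) m
      c₂ = X p₁ (X p₃ S₂₃F) m
      c₃ = X p₂ (X p₃ W) m
      eq₁ : b₃ - a₃ ≡ c₁ - c₂
      eq₁ = trans (cong₂ _-_ (X-X p₂ p₁ G m) (X-X p₃ p₁ G m)) (X-cong-⊟ p₁ p₂ p₃ G F S₂₃F G≡ξF m)
      eq₂ : a₂ - a₄ ≡ c₁ - c₃
      eq₂ = trans (cong₂ _-_ (X-X p₁ p₂ S₁₂G m) (X-X p₃ p₂ S₁₂G m))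
                  (trans (X-cong-⊟ p₂ p₁ p₃ S₁₂G F W S₁₂G-rel m) (cong (_- c₃) (X-X p₂ p₁ F m)))
      eq₃ : b₂ - b₄ ≡ c₂ - c₃
      eq₃ = trans (cong₂ _-_ (X-X p₁ p₃ T m) (X-X p₂ p₃ T m))
                  (trans (X-cong-⊟ p₃ p₁ p₂ T S₂₃F W T-rel m)
                         (cong₂ _-_ (X-X p₃ p₁ S₂₃F m) (X-X p₃ p₂ W m)))

  demazure-braid₂ : (F G H : Coeffs n) → Sw p₂ p₃ F ≗ F →
    IsDemazure p₁ p₂ F G → IsDemazure p₂ p₃ G H → Sw p₁ p₂ H ≗ H
  demazure-braid₂ F G H F-sym G≡ξF H≡ξG =
    ≗.sym (cancel-Δ p₂ p₃ p₂≢p₃ (cancel-Δ p₁ p₃ p₁≢p₃ expanded))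
    where
    S₂₃G = Sw p₂ p₃ G
    S₁₂F = Sw p₁ p₂ F
    T = Sw p₁ p₂ S₂₃G
    Z = Sw p₂ p₃ S₁₂F
    SH = Sw p₁ p₂ H
    G-sym : Sw p₁ p₂ G ≗ G
    G-sym = demazure-symmetric p₁ p₂ p₁≢p₂ F G G≡ξF
    Z-sym : Sw p₁ p₂ Z ≗ Z
    Z-sym m = trans (sym (Sw-braid F m)) (F-sym (swapAt p₁ p₂ (swapAt p₂ p₃ m)))
    SH-rel : Δ p₁ p₃ SH ≗ X p₁ G ⊟ X p₃ T
    SH-rel m = trans (Sw-X⊟X p₁ p₂ H G S₂₃G τ₁₂p₂ τ₁₂p₃ τ₁₂p₂ τ₁₂p₃ H≡ξG m)
                     (cong (_- X p₃ T m) (X-cong p₁ G-sym m))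
    S₂₃G-rel : Δ p₁ p₃ S₂₃G ≗ X p₁ F ⊟ X p₃ Z
    S₂₃G-rel m = trans (Sw-X⊟X p₂ p₃ G F S₁₂F τ₂₃p₁ τ₂₃p₂ τ₂₃p₁ τ₂₃p₂ G≡ξF m)
                       (cong (_- X p₃ Z m) (X-cong p₁ F-sym m))
    T-rel : Δ p₂ p₃ T ≗ X p₂ S₁₂F ⊟ X p₃ Z
    T-rel m = trans (Sw-X⊟X p₁ p₂ S₂₃G F Z τ₁₂p₁ τ₁₂p₃ τ₁₂p₁ τ₁₂p₃ S₂₃G-rel m)
                    (cong (λ x → X p₂ S₁₂F m - x) (X-cong p₃ Z-sym m))
    expanded : Δ p₁ p₃ (Δ p₂ p₃ H) ≗ Δ p₁ p₃ (Δ p₂ p₃ SH)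
    expanded m = begin
      Δ p₁ p₃ (Δ p₂ p₃ H) m
        ≡⟨ cong₂ _-_ (X-cong p₁ H≡ξG m) (X-cong p₃ H≡ξG m) ⟩
      Δ p₁ p₃ (X p₂ G ⊟ X p₃ S₂₃G) m
        ≡⟨ cong₂ _-_ (X-⊟ p₁ (X p₂ G) (X p₃ S₂₃G) m) (X-⊟ p₃ (X p₂ G) (X p₃ S₂₃G) m) ⟩
      (X p₁ (X p₂ G) m - a₂) - (a₃ - a₄)
        ≡⟨ cong (λ x → (x - a₂) - (a₃ - a₄)) (X-X p₁ p₂ G m) ⟩
      (u - a₂) - (a₃ - a₄)
        ≡⟨ braid-arithmetic u a₂ a₃ a₄ b₂ b₃ b₄ c₁ c₂ c₃ eq₁ eq₂ eq₃ ⟩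
      (u - b₂) - (b₃ - b₄)
        ≡⟨ cong₂ _-_ (X-⊟ p₂ (X p₁ G) (X p₃ T) m) (X-⊟ p₃ (X p₁ G) (X p₃ T) m) ⟨
      Δ p₂ p₃ (X p₁ G ⊟ X p₃ T) m
        ≡⟨ cong₂ _-_ (X-cong p₂ SH-rel m) (X-cong p₃ SH-rel m) ⟨
      Δ p₂ p₃ (Δ p₁ p₃ SH) m
        ≡⟨ Δ-Δ p₁ p₂ p₃ p₃ SH m ⟨
      Δ p₁ p₃ (Δ p₂ p₃ SH) m ∎
      where
      open ≡-Reasoning
      u = X p₂ (X p₁ G) m
      a₂ = X p₁ (X p₃ S₂₃G) m
      a₃ = X p₃ (X p₂ G) m
      a₄ = X p₃ (X p₃ S₂₃G) m
      b₂ = X p₂ (X p₃ T) m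
      b₃ = X p₃ (X p₁ G) m
      b₄ = X p₃ (X p₃ T) m
      c₁ = X p₃ (X p₁ F) m
      c₂ = X p₃ (X p₂ S₁₂F) m
      c₃ = X p₃ (X p₃ Z) m
      eq₁ : b₃ - a₃ ≡ c₁ - c₂
      eq₁ = X-cong-⊟ p₃ p₁ p₂ G F S₁₂F G≡ξF m
      eq₂ : a₂ - a₄ ≡ c₁ - c₃
      eq₂ = trans (cong (_- a₄) (X-X p₁ p₃ S₂₃G m)) (X-cong-⊟ p₃ p₁ p₃ S₂₃G F Z S₂₃G-rel m)
      eq₃ : b₂ - b₄ ≡ c₂ - c₃
      eq₃ = trans (cong (_- b₄) (X-X p₂ p₃ T m)) (X-cong-⊟ p₃ p₂ p₃ T S₁₂F Z T-rel m)

inject₁≢suc : ∀ {n} (i : Fin n) → inject₁ i ≢ suc i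
inject₁≢suc zero = λ ()
inject₁≢suc (suc i) = inject₁≢suc i ∘ FinP.suc-injective

inject₁²≢suc² : ∀ {n} (i : Fin n) → inject₁ (inject₁ i) ≢ suc (suc i)
inject₁²≢suc² zero = λ ()
inject₁²≢suc² (suc i) = inject₁²≢suc² i ∘ FinP.suc-injective

data Adjacency : ∀ {m} → Fin m → Fin m → Set where
  same : ∀ {m} {i : Fin m} → Adjacency i i
  left : ∀ {m} (i : Fin m) → Adjacency (inject₁ i) (suc i)
  right : ∀ {m} (i : Fin m) → Adjacency (suc i) (inject₁ i)
  apart : ∀ {m} {i j : Fin m} → inject₁ i ≢ inject₁ j → inject₁ i ≢ suc j →
          suc i ≢ inject₁ j → suc i ≢ suc j → Adjacency i j

adjacency : ∀ {m} (i j : Fin m) → Adjacency i j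
adjacency zero zero = same
adjacency zero (suc zero) = left zero
adjacency zero (suc (suc j)) = apart (λ ()) (λ ()) (λ ()) (λ ())
adjacency (suc zero) zero = right zero
adjacency (suc (suc i)) zero = apart (λ ()) (λ ()) (λ ()) (λ ())
adjacency (suc i) (suc j) with adjacency i j
... | same = same
... | left i′ = left (suc i′)
... | right i′ = right (suc i′)
... | apart ne₁ ne₂ ne₃ ne₄ =
  apart (ne₁ ∘ FinP.suc-injective) (ne₂ ∘ FinP.suc-injective)
        (ne₃ ∘ FinP.suc-injective) (ne₄ ∘ FinP.suc-injective)

punchIn-inject₁-self : ∀ {n} (i : Fin n) → punchIn (inject₁ i) i ≡ suc i
punchIn-inject₁-self zero = refl
punchIn-inject₁-self (suc i) = cong suc (punchIn-inject₁-self i)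

punchIn-adjacent : ∀ {n} (p : Fin (suc (suc n))) (i : Fin (suc n)) → p ≢ inject₁ i → p ≢ suc i →
  Σ (Fin n) λ i′ → punchIn p (inject₁ i′) ≡ inject₁ i × punchIn p (suc i′) ≡ suc i
punchIn-adjacent zero zero p≢a p≢b = ⊥-elim (p≢a refl)
punchIn-adjacent zero (suc i) p≢a p≢b = i , refl , refl
punchIn-adjacent (suc zero) zero p≢a p≢b = ⊥-elim (p≢b refl)
punchIn-adjacent {suc n} (suc (suc p)) zero p≢a p≢b = zero , refl , refl
punchIn-adjacent {suc n} (suc p) (suc i) p≢a p≢b
  with punchIn-adjacent p i (p≢a ∘ cong suc) (p≢b ∘ cong suc)
... | i′ , eq₁ , eq₂ = suc i′ , cong suc eq₁ , cong suc eq₂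

Ascent : ∀ {m} → Vec ℕ (suc m) → Fin m → Set
Ascent α i = lookup α (inject₁ i) < lookup α (suc i)

decreasing-or-ascent : ∀ {m} (α : Vec ℕ (suc m)) → Decreasing α ⊎ Σ (Fin m) (Ascent α)
decreasing-or-ascent {zero} (x ∷ []) = inj₁ λ { zero zero _ → ℕP.≤-refl }
decreasing-or-ascent {suc m} (x ∷ y ∷ zs) with decreasing-or-ascent (y ∷ zs)
... | inj₂ (i , asc) = inj₂ (suc i , asc)
... | inj₁ dec with y ℕ.≤? x
...   | no y≰x = inj₂ (zero , ℕP.≰⇒> y≰x)
...   | yes y≤x = inj₁ dec′
  where
  dec′ : Decreasing (x ∷ y ∷ zs)
  dec′ zero zero _ = ℕP.≤-refl
  dec′ zero (suc j) _ = ℕP.≤-trans (dec zero j z≤n) y≤x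
  dec′ (suc i) (suc j) (s≤s i≤j) = dec i j i≤j

positionWeight : ∀ {n} → Vec ℕ n → ℕ
positionWeight [] = 0
positionWeight (x ∷ xs) = Vec.sum xs ℕ.+ positionWeight xs

sum-swapV : ∀ {m} (i : Fin m) (α : Vec ℕ (suc m)) → Vec.sum (swapV i α) ≡ Vec.sum α
sum-swapV zero (x ∷ y ∷ zs) = x∙yz≈y∙xz y x (Vec.sum zs)
sum-swapV (suc i) (x ∷ xs) = cong (x ℕ.+_) (sum-swapV i xs)

positionWeight-swapV : ∀ {m} (i : Fin m) (α : Vec ℕ (suc m)) → Ascent α i →
  positionWeight (swapV i α) < positionWeight α
positionWeight-swapV zero (x ∷ y ∷ zs) x<y = ℕP.+-monoˡ-< _ (ℕP.+-monoˡ-< (Vec.sum zs) x<y)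
positionWeight-swapV (suc i) (x ∷ xs) asc rewrite sum-swapV i xs =
  ℕP.+-monoʳ-< (Vec.sum xs) (positionWeight-swapV i xs asc)

removeAt-decreasing : ∀ {n} (α : Vec ℕ (suc n)) p → Decreasing α → Decreasing (removeAt α p)
removeAt-decreasing α p dec i j i≤j = subst₂ _≤_ (sym (lookup-removeAt α p j)) (sym (lookup-removeAt α p i))
  (dec (punchIn p i) (punchIn p j) (FinP.punchIn-mono-≤ p i j i≤j))

setZero-indicator : ∀ {n} (α : Vec ℕ (suc n)) p → lookup α p ≡ 0 →
  setZero p (indicator α) ≗ indicator (removeAt α p)
setZero-indicator α p αp≡0 m with VecP.≡-dec _≟_ α (insertAt m p 0) | VecP.≡-dec _≟_ (removeAt α p) m
... | yes _ | yes _ = refl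
... | no _ | no _ = refl
... | yes α≡ | no α′≢ =
  ⊥-elim (α′≢ (trans (cong (λ v → removeAt v p) α≡) (VecP.removeAt-insertAt m p 0)))
... | no α≢ | yes refl =
  ⊥-elim (α≢ (trans (sym (VecP.insertAt-removeAt α p)) (cong (insertAt (removeAt α p) p) αp≡0)))

IncreasingBetween : ∀ {M} → Vec ℕ (suc M) → Fin (suc M) → Fin (suc M) → Set
IncreasingBetween {M} v q p =
  ∀ (j : Fin M) → toℕ q ≤ toℕ j → toℕ j < toℕ p → lookup v (inject₁ j) ≤ lookup v (suc j)

record DeletionData {N M} (γ : Vec ℕ N) (γ′ : Vec ℕ M) (insert : Vec ℕ M → Vec ℕ N) : Set where
  field
    N≡1+M : N ≡ suc M
    zeroPos lastPos : Fin (suc M)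
    insert≡insertAt : ∀ m → Vec.cast N≡1+M (insert m) ≡ insertAt m lastPos 0
    γ-zeroPos : lookup (Vec.cast N≡1+M γ) zeroPos ≡ 0
    removeAt-zeroPos : removeAt (Vec.cast N≡1+M γ) zeroPos ≡ γ′
    zeroPos≤lastPos : toℕ zeroPos ≤ toℕ lastPos
    increasing : IncreasingBetween (Vec.cast N≡1+M γ) zeroPos lastPos

-- Key polynomials

module KeyPolynomials (K : ∀ {n} → Vec ℕ n → Poly n) (isK : IsKeyPolynomials K) where
  open IsKeyPolynomials isK

  k : ∀ {n} → Vec ℕ n → Coeffs n
  k α = coeff (K α)

  k-cong : ∀ {n} {α β : Vec ℕ n} → α ≡ β → k α ≗ k β
  k-cong refl _ = refl

  k-dominant : ∀ {n} (α : Vec ℕ n) → Decreasing α → k α ≗ indicator α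
  k-dominant α dec m = trans (key-dominant α dec m) (coeff-monomial α m)

  k-demazure : ∀ {m} (α : Vec ℕ (suc m)) (i : Fin m) → Ascent α i →
    IsDemazure (inject₁ i) (suc i) (k (swapV i α)) (k α)
  k-demazure α i asc m = begin
    Δ a b (k α) m
      ≡⟨ X-⊟-cong a b (k-cong (sym α≡ssα)) (k-cong (sym α≡ssα)) m ⟩
    Δ a b (k (swapV i β)) m
      ≡⟨ coeff-mulX-⊖ (K (swapV i β)) (K (swapV i β)) m ⟨
    coeff (mulX a (K (swapV i β)) ⊖ mulX b (K (swapV i β))) m
      ≡⟨ key-step β i β-descent m ⟩
    coeff (mulX a (K β) ⊖ mulX b (σ i (K β))) m
      ≡⟨ coeff-mulX-⊖ (K β) (σ i (K β)) m ⟩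
    X a (k β) m - X b (coeff (σ i (K β))) m
      ≡⟨ cong (λ q → X a (k β) m - q) (X-cong b (coeff-σ i (K β)) m) ⟩
    X a (k β) m - X b (Sw a b (k β)) m ∎
    where
    open ≡-Reasoning
    a = inject₁ i
    b = suc i
    β = swapV i α
    α≡ssα : swapV i β ≡ α
    α≡ssα = swapAt-involutive a b α
    β-descent : lookup β b < lookup β a
    β-descent = subst₂ _<_ (sym (lookup-swapAt-right a b α)) (sym (lookup-swapAt-left a b α)) asc
    coeff-mulX-⊖ : (p q : Poly (suc _)) → coeff (mulX a p ⊖ mulX b q) ≗ X a (coeff p) ⊟ X b (coeff q)
    coeff-mulX-⊖ p q m = trans (coeff-⊖ (mulX a p) (mulX b q) m) (cong₂ _-_ (coeff-mulX a p m) (coeff-mulX b q m))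

  k-symmetric-ascent : ∀ {m} (α : Vec ℕ (suc m)) (i : Fin m) → Ascent α i →
    Sw (inject₁ i) (suc i) (k α) ≗ k α
  k-symmetric-ascent α i asc =
    demazure-symmetric (inject₁ i) (suc i) (inject₁≢suc i) (k (swapV i α)) (k α) (k-demazure α i asc)

  indicator-symmetric : ∀ {n} (a b : Fin n) (α : Vec ℕ n) → swapAt a b α ≡ α →
    Sw a b (indicator α) ≗ indicator α
  indicator-symmetric a b α α-sym m with VecP.≡-dec _≟_ α (swapAt a b m) | VecP.≡-dec _≟_ α m
  ... | yes _ | yes _ = refl
  ... | no _ | no _ = refl
  ... | yes α≡sm | no α≢m =
    ⊥-elim (α≢m (trans (sym α-sym) (trans (cong (swapAt a b) α≡sm) (swapAt-involutive a b m))))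
  ... | no α≢sm | yes refl = ⊥-elim (α≢sm (sym α-sym))

  private
    SymmetricBelow : ∀ {m} → ℕ → Set
    SymmetricBelow {m} w = ∀ (β : Vec ℕ (suc m)) → positionWeight β < w →
      ∀ j → lookup β (inject₁ j) ≤ lookup β (suc j) → Sw (inject₁ j) (suc j) (k β) ≗ k β

    symmetric-left : ∀ {m} (α : Vec ℕ (suc (suc m))) (i : Fin m) → SymmetricBelow (positionWeight α) →
      Ascent α (inject₁ i) → lookup α (inject₁ (suc i)) ≡ lookup α (suc (suc i)) →
      Sw (inject₁ (suc i)) (suc (suc i)) (k α) ≗ k α
    symmetric-left α i IH asc flat =
      Braid.demazure-braid₁ p₁ p₂ p₃ p₁≢p₂ p₂≢p₃ p₁≢p₃ (k β′) (k β) (k α)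
      F-sym (k-demazure β (suc i) β-asc) (k-demazure α (inject₁ i) asc)
      where
      p₁ = inject₁ (inject₁ i)
      p₂ = suc (inject₁ i)
      p₃ = suc (suc i)
      p₁≢p₂ = inject₁≢suc (inject₁ i)
      p₂≢p₃ = inject₁≢suc (suc i)
      p₁≢p₃ = inject₁²≢suc² i
      β = swapAt p₁ p₂ α
      β′ = swapAt p₂ p₃ β
      β₁ : lookup β p₁ ≡ lookup α p₂
      β₁ = lookup-swapAt-left p₁ p₂ α
      β₂ : lookup β p₂ ≡ lookup α p₁
      β₂ = lookup-swapAt-right p₁ p₂ α
      β₃ : lookup β p₃ ≡ lookup α p₃
      β₃ = lookup-swapAt-other p₁ p₂ p₃ α (p₁≢p₃ ∘ sym) (p₂≢p₃ ∘ sym)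
      β-asc : Ascent β (suc i)
      β-asc = subst₂ _<_ (sym β₂) (sym β₃) (subst (lookup α p₁ <_) flat asc)
      β′-flat : lookup β′ p₁ ≡ lookup β′ p₂
      β′-flat = begin
        lookup β′ p₁   ≡⟨ lookup-swapAt-other p₂ p₃ p₁ β p₁≢p₂ p₁≢p₃ ⟩
        lookup β p₁    ≡⟨ β₁ ⟩
        lookup α p₂    ≡⟨ flat ⟩
        lookup α p₃    ≡⟨ β₃ ⟨
        lookup β p₃    ≡⟨ lookup-swapAt-left p₂ p₃ β ⟨
        lookup β′ p₂   ∎
        where open ≡-Reasoning
      F-sym : Sw p₁ p₂ (k β′) ≗ k β′
      F-sym = IH β′ (ℕP.<-trans (positionWeight-swapV (suc i) β β-asc) (positionWeight-swapV (inject₁ i) α asc))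
                 (inject₁ i) (ℕP.≤-reflexive β′-flat)

    symmetric-right : ∀ {m} (α : Vec ℕ (suc (suc m))) (i : Fin m) → SymmetricBelow (positionWeight α) →
      Ascent α (suc i) → lookup α (inject₁ (inject₁ i)) ≡ lookup α (suc (inject₁ i)) →
      Sw (inject₁ (inject₁ i)) (suc (inject₁ i)) (k α) ≗ k α
    symmetric-right α i IH asc flat =
      Braid.demazure-braid₂ p₁ p₂ p₃ p₁≢p₂ p₂≢p₃ p₁≢p₃ (k β′) (k β) (k α)
      F-sym (k-demazure β (inject₁ i) β-asc) (k-demazure α (suc i) asc)
      where
      p₁ = inject₁ (inject₁ i)
      p₂ = suc (inject₁ i)
      p₃ = suc (suc i)
      p₁≢p₂ = inject₁≢suc (inject₁ i)
      p₂≢p₃ = inject₁≢suc (suc i)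
      p₁≢p₃ = inject₁²≢suc² i
      β = swapAt p₂ p₃ α
      β′ = swapAt p₁ p₂ β
      β₁ : lookup β p₁ ≡ lookup α p₁
      β₁ = lookup-swapAt-other p₂ p₃ p₁ α p₁≢p₂ p₁≢p₃
      β₂ : lookup β p₂ ≡ lookup α p₃
      β₂ = lookup-swapAt-left p₂ p₃ α
      β₃ : lookup β p₃ ≡ lookup α p₂
      β₃ = lookup-swapAt-right p₂ p₃ α
      β-asc : Ascent β (inject₁ i)
      β-asc = subst₂ _<_ (sym β₁) (sym β₂) (subst (_< lookup α p₃) (sym flat) asc)
      β′-flat : lookup β′ p₂ ≡ lookup β′ p₃
      β′-flat = begin
        lookup β′ p₂   ≡⟨ lookup-swapAt-right p₁ p₂ β ⟩
        lookup β p₁    ≡⟨ β₁ ⟩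
        lookup α p₁    ≡⟨ flat ⟩
        lookup α p₂    ≡⟨ β₃ ⟨
        lookup β p₃    ≡⟨ lookup-swapAt-other p₁ p₂ p₃ β (p₁≢p₃ ∘ sym) (p₂≢p₃ ∘ sym) ⟨
        lookup β′ p₃   ∎
        where open ≡-Reasoning
      F-sym : Sw p₂ p₃ (k β′) ≗ k β′
      F-sym = IH β′ (ℕP.<-trans (positionWeight-swapV (inject₁ i) β β-asc) (positionWeight-swapV (suc i) α asc))
                 (suc i) (ℕP.≤-reflexive β′-flat)

    symmetric-apart : ∀ {m} (α : Vec ℕ (suc m)) (i j : Fin m) → SymmetricBelow (positionWeight α) → Ascent α i →
      lookup α (inject₁ j) ≡ lookup α (suc j) →
      inject₁ i ≢ inject₁ j → inject₁ i ≢ suc j → suc i ≢ inject₁ j → suc i ≢ suc j →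
      Sw (inject₁ j) (suc j) (k α) ≗ k α
    symmetric-apart α i j IH asc flat a≢c a≢d b≢c b≢d =
      demazure-Sw-disjoint a b c d (inject₁≢suc i) a≢c a≢d b≢c b≢d (k β) (k α) (k-demazure α i asc)
        (IH β (positionWeight-swapV i α asc) j (ℕP.≤-reflexive β-flat))
      where
      a = inject₁ i
      b = suc i
      c = inject₁ j
      d = suc j
      β = swapV i α
      β-flat : lookup β c ≡ lookup β d
      β-flat = trans (lookup-swapAt-other a b c α (a≢c ∘ sym) (b≢c ∘ sym))
                (trans flat (sym (lookup-swapAt-other a b d α (a≢d ∘ sym) (b≢d ∘ sym))))

  k-symmetric : ∀ {m} (α : Vec ℕ (suc m)) (j : Fin m) → lookup α (inject₁ j) ≤ lookup α (suc j) →
    Sw (inject₁ j) (suc j) (k α) ≗ k α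
  k-symmetric α = go α (<-wellFounded (positionWeight α))
    where
    go : ∀ {m} (α : Vec ℕ (suc m)) → Acc _<_ (positionWeight α) →
      ∀ j → lookup α (inject₁ j) ≤ lookup α (suc j) →
      Sw (inject₁ j) (suc j) (k α) ≗ k α
    go α (acc rec) j αj≤αj+1 with ℕP.m≤n⇒m<n∨m≡n αj≤αj+1
    ... | inj₁ asc = k-symmetric-ascent α j asc
    ... | inj₂ flat with decreasing-or-ascent α
    ...   | inj₁ dec = λ m → begin
      k α (swapAt (inject₁ j) (suc j) m)
        ≡⟨ k-dominant α dec _ ⟩
      indicator α (swapAt (inject₁ j) (suc j) m)
        ≡⟨ indicator-symmetric (inject₁ j) (suc j) α (swapAt-of-equal _ _ α flat) m ⟩
      indicator α m
        ≡⟨ k-dominant α dec m ⟨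
      k α m ∎
      where open ≡-Reasoning
    ...   | inj₂ (i , asc) with adjacency i j
    ...     | same = ⊥-elim (ℕP.<⇒≢ asc flat)
    ...     | left i′ = symmetric-left α i′ (λ β lt → go β (rec lt)) asc flat
    ...     | right i′ = symmetric-right α i′ (λ β lt → go β (rec lt)) asc flat
    ...     | apart a≢c a≢d b≢c b≢d =
      symmetric-apart α i j (λ β lt → go β (rec lt)) asc flat a≢c a≢d b≢c b≢d

  private
    setZero-descent : ∀ {n} (i : Fin n) (f P Q : Coeffs (suc n)) →
      Δ (inject₁ i) (suc i) f ≗ X (inject₁ i) P ⊟ X (suc i) Q →
      setZero (inject₁ i) f ≗ setZero (inject₁ i) Q
    setZero-descent i f P Q eq = cancel-X i λ m → ℚP.neg-injective (begin
      - X i (setZero a f) m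
        ≡⟨ ℚP.+-identityˡ _ ⟨
      0ℚ - X i (setZero a f) m
        ≡⟨ cong₂ _-_ (setZero-X-self a f m) (setZero-X′ f m) ⟨
      X a f (insertAt m a 0) - X (suc i) f (insertAt m a 0)
        ≡⟨ eq (insertAt m a 0) ⟩
      X a P (insertAt m a 0) - X (suc i) Q (insertAt m a 0)
        ≡⟨ cong₂ _-_ (setZero-X-self a P m) (setZero-X′ Q m) ⟩
      0ℚ - X i (setZero a Q) m
        ≡⟨ ℚP.+-identityˡ _ ⟩
      - X i (setZero a Q) m ∎)
      where
      open ≡-Reasoning
      a = inject₁ i
      setZero-X′ : (g : Coeffs (suc _)) → setZero a (X (suc i) g) ≗ X i (setZero a g)
      setZero-X′ g = subst (λ b → setZero a (X b g) ≗ X i (setZero a g)) (punchIn-inject₁-self i) (setZero-X a i g)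

  k-setZero : ∀ {n} (α : Vec ℕ (suc n)) (p : Fin (suc n)) → lookup α p ≡ 0 →
    setZero p (k α) ≗ k (removeAt α p)
  k-setZero α = go α (<-wellFounded (positionWeight α))
    where
    go : ∀ {n} (α : Vec ℕ (suc n)) → Acc _<_ (positionWeight α) → ∀ p → lookup α p ≡ 0 →
      setZero p (k α) ≗ k (removeAt α p)
    go α (acc rec) p αp≡0 with decreasing-or-ascent α
    ... | inj₁ dec = λ m → begin
      k α (insertAt m p 0)          ≡⟨ k-dominant α dec _ ⟩
      indicator α (insertAt m p 0)  ≡⟨ setZero-indicator α p αp≡0 m ⟩
      indicator (removeAt α p) m    ≡⟨ k-dominant (removeAt α p) (removeAt-decreasing α p dec) m ⟨
      k (removeAt α p) m            ∎
      where open ≡-Reasoning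
    ... | inj₂ (i , asc) with p Fin.≟ suc i | p Fin.≟ inject₁ i
    ...   | yes refl | _ = ⊥-elim (ℕP.n≮0 (subst (lookup α (inject₁ i) <_) αp≡0 asc))
    ...   | no _ | yes refl = λ m → begin
      setZero a (k α) m
        ≡⟨ setZero-descent i (k α) (k β) (Sw a b (k β)) (k-demazure α i asc) m ⟩
      setZero a (Sw a b (k β)) m
        ≡⟨ setZero-suc i (k β) m ⟨
      setZero b (k β) m
        ≡⟨ go β (rec (positionWeight-swapV i α asc)) b (trans (lookup-swapAt-right a b α) αp≡0) m ⟩
      k (removeAt β b) m
        ≡⟨ k-cong (removeAt-swapV i α) m ⟩
      k (removeAt α a) m ∎
      where
      open ≡-Reasoning
      a = inject₁ i
      b = suc i
      β = swapV i α
    go {suc n} α (acc rec) p αp≡0 | inj₂ (i , asc) | no p≢b | no p≢a with punchIn-adjacent p i p≢a p≢b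
    ... | i′ , pa′≡a , pb′≡b =
      demazure-unique a′ b′ (inject₁≢suc i′) setZero-α-rel (k-demazure α′ i′ α′-asc) F≗F′
      where
      a′ = inject₁ i′
      b′ = suc i′
      β = swapV i α
      α′ = removeAt α p
      α-rel : IsDemazure (punchIn p a′) (punchIn p b′) (k β) (k α)
      α-rel = subst₂ (λ a b → IsDemazure a b (k β) (k α)) (sym pa′≡a) (sym pb′≡b) (k-demazure α i asc)
      setZero-α-rel : IsDemazure a′ b′ (setZero p (k β)) (setZero p (k α))
      setZero-α-rel = setZero-demazure p a′ b′ (k β) (k α) α-rel
      α′-asc : Ascent α′ i′
      α′-asc = subst₂ _<_ (sym (trans (lookup-removeAt α p a′) (cong (lookup α) pa′≡a)))
                          (sym (trans (lookup-removeAt α p b′) (cong (lookup α) pb′≡b))) asc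
      β′≡ : removeAt β p ≡ swapV i′ α′
      β′≡ = subst₂ (λ a b → removeAt (swapAt a b α) p ≡ swapV i′ α′) pa′≡a pb′≡b
                   (removeAt-swapAt α p a′ b′)
      F≗F′ : setZero p (k β) ≗ k (swapV i′ α′)
      F≗F′ = ≗.trans (go β (rec (positionWeight-swapV i α asc)) p
                        (trans (lookup-swapAt-other (inject₁ i) (suc i) p α p≢a p≢b) αp≡0))
                     (k-cong β′≡)

  k-setZero-slide : ∀ {M} (γ : Vec ℕ (suc M)) (q : Fin (suc M)) d (p : Fin (suc M)) → toℕ p ≡ toℕ q ℕ.+ d →
    IncreasingBetween γ q p → setZero p (k γ) ≗ setZero q (k γ)
  k-setZero-slide γ q zero p p≡q+0 _
    rewrite FinP.toℕ-injective (trans p≡q+0 (ℕP.+-identityʳ (toℕ q))) = λ _ → refl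
  k-setZero-slide γ q (suc d) zero 0≡q+1+d _ = ⊥-elim (ℕP.0≢1+n (trans 0≡q+1+d (ℕP.+-suc (toℕ q) d)))
  k-setZero-slide γ q (suc d) (suc j) j+1≡q+1+d increasing m = begin
    setZero (suc j) (k γ) m
      ≡⟨ setZero-suc j (k γ) m ⟩
    setZero (inject₁ j) (Sw (inject₁ j) (suc j) (k γ)) m
      ≡⟨ k-symmetric γ j (increasing j q≤j (ℕP.n<1+n _)) _ ⟩
    setZero (inject₁ j) (k γ) m
      ≡⟨ k-setZero-slide γ q d (inject₁ j) j≡q+d increasing′ m ⟩
    setZero q (k γ) m ∎
    where
    open ≡-Reasoning
    j≡q+d : toℕ (inject₁ j) ≡ toℕ q ℕ.+ d
    j≡q+d = trans (FinP.toℕ-inject₁ j) (ℕP.suc-injective (trans j+1≡q+1+d (ℕP.+-suc (toℕ q) d)))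
    q≤j : toℕ q ≤ toℕ j
    q≤j = subst (toℕ q ≤_) (sym (trans (sym (FinP.toℕ-inject₁ j)) j≡q+d)) (ℕP.m≤m+n (toℕ q) d)
    increasing′ : IncreasingBetween γ q (inject₁ j)
    increasing′ j′ q≤j′ j′<j = increasing j′ q≤j′
      (ℕP.<-trans (subst (toℕ j′ <_) (FinP.toℕ-inject₁ j) j′<j) (ℕP.n<1+n _))

  k-setZero-increasing : ∀ {M} (γ : Vec ℕ (suc M)) (q p : Fin (suc M)) → lookup γ q ≡ 0 → toℕ q ≤ toℕ p →
    IncreasingBetween γ q p → setZero p (k γ) ≗ k (removeAt γ q)
  k-setZero-increasing γ q p γq≡0 q≤p increasing =
    ≗.trans (k-setZero-slide γ q (toℕ p ℕ.∸ toℕ q) p (sym (ℕP.m+[n∸m]≡n q≤p)) increasing)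
            (k-setZero γ q γq≡0)

  k-deletion : ∀ {N M} {γ : Vec ℕ N} {γ′ : Vec ℕ M} {insert : Vec ℕ M → Vec ℕ N} →
    DeletionData γ γ′ insert → ∀ m → k γ (insert m) ≡ k γ′ m
  k-deletion {γ = γ} {γ′} {insert} record
    { N≡1+M = refl ; zeroPos = q ; lastPos = p ; insert≡insertAt = insert≡insertAt ; γ-zeroPos = γ-zeroPos
    ; removeAt-zeroPos = removeAt-zeroPos ; zeroPos≤lastPos = q≤p ; increasing = increasing } m = begin
    k γ (insert m)
      ≡⟨ cong₂ k (sym (VecP.cast-is-id refl γ)) (sym (VecP.cast-is-id refl (insert m))) ⟩
    k (Vec.cast refl γ) (Vec.cast refl (insert m))
      ≡⟨ cong (k (Vec.cast refl γ)) (insert≡insertAt m) ⟩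
    setZero p (k (Vec.cast refl γ)) m
      ≡⟨ k-setZero-increasing (Vec.cast refl γ) q p γ-zeroPos q≤p increasing m ⟩
    k (removeAt (Vec.cast refl γ) q) m
      ≡⟨ k-cong removeAt-zeroPos m ⟩
    k γ′ m ∎
    where open ≡-Reasoning

-- The substitution Ξ

take-++ : ∀ {m n} (u : Vec ℕ m) (w : Vec ℕ n) → Vec.take m (u Vec.++ w) ≡ u
take-++ {m} u w = VecP.++-injectiveˡ _ u (VecP.take++drop≡id m (u Vec.++ w))

drop-++ : ∀ {m n} (u : Vec ℕ m) (w : Vec ℕ n) → Vec.drop m (u Vec.++ w) ≡ w
drop-++ {m} u w = VecP.++-injectiveʳ _ u (VecP.take++drop≡id m (u Vec.++ w))

insertLastOfBlock : ∀ {r} (ns : Vec ℕ r) (i : Fin r) → 1 ≤ lookup ns i →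
  Vec ℕ (Vec.sum (ns [ i ]%= pred)) → Vec ℕ (Vec.sum ns)
insertLastOfBlock (n ∷ ns) (suc i) 1≤nᵢ m = Vec.take n m Vec.++ insertLastOfBlock ns i 1≤nᵢ (Vec.drop n m)
insertLastOfBlock (suc n ∷ ns) zero _ m = (Vec.take n m Vec.∷ʳ 0) Vec.++ Vec.drop n m

module _ where
  open ≡-Reasoning

  lastOfBlock-insert : ∀ {r} (ns : Vec ℕ r) (i : Fin r) (1≤nᵢ : 1 ≤ lookup ns i) m →
    lastOfBlock ns i (insertLastOfBlock ns i 1≤nᵢ m) ≡ 0
  lastOfBlock-insert (suc n ∷ ns) zero _ m = begin
    Vec.last (Vec.take (suc n) ((Vec.take n m Vec.∷ʳ 0) Vec.++ Vec.drop n m))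
      ≡⟨ cong Vec.last (take-++ (Vec.take n m Vec.∷ʳ 0) (Vec.drop n m)) ⟩
    Vec.last (Vec.take n m Vec.∷ʳ 0)
      ≡⟨ VecP.last-∷ʳ 0 (Vec.take n m) ⟩
    0 ∎
  lastOfBlock-insert (n ∷ ns) (suc i) 1≤nᵢ m =
    trans (cong (lastOfBlock ns i) (drop-++ (Vec.take n m) _)) (lastOfBlock-insert ns i 1≤nᵢ (Vec.drop n m))

  dropInBlock-insert : ∀ {r} (ns : Vec ℕ r) (i : Fin r) (1≤nᵢ : 1 ≤ lookup ns i) m →
    dropInBlock ns i (insertLastOfBlock ns i 1≤nᵢ m) ≡ m
  dropInBlock-insert (suc n ∷ ns) zero _ m = begin
    Vec.init (Vec.take (suc n) v) Vec.++ Vec.drop (suc n) v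
      ≡⟨ cong₂ (λ u w → Vec.init u Vec.++ w) (take-++ (Vec.take n m Vec.∷ʳ 0) (Vec.drop n m))
                                              (drop-++ (Vec.take n m Vec.∷ʳ 0) (Vec.drop n m)) ⟩
    Vec.init (Vec.take n m Vec.∷ʳ 0) Vec.++ Vec.drop n m
      ≡⟨ cong (Vec._++ Vec.drop n m) (VecP.init-∷ʳ 0 (Vec.take n m)) ⟩
    Vec.take n m Vec.++ Vec.drop n m
      ≡⟨ VecP.take++drop≡id n m ⟩
    m ∎
    where v = (Vec.take n m Vec.∷ʳ 0) Vec.++ Vec.drop n m
  dropInBlock-insert (n ∷ ns) (suc i) 1≤nᵢ m = begin
    Vec.take n v Vec.++ dropInBlock ns i (Vec.drop n v)
      ≡⟨ cong₂ Vec._++_ (take-++ (Vec.take n m) _) (cong (dropInBlock ns i) (drop-++ (Vec.take n m) _)) ⟩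
    Vec.take n m Vec.++ dropInBlock ns i (insertLastOfBlock ns i 1≤nᵢ (Vec.drop n m))
      ≡⟨ cong (Vec.take n m Vec.++_) (dropInBlock-insert ns i 1≤nᵢ (Vec.drop n m)) ⟩
    Vec.take n m Vec.++ Vec.drop n m
      ≡⟨ VecP.take++drop≡id n m ⟩
    m ∎
    where v = Vec.take n m Vec.++ insertLastOfBlock ns i 1≤nᵢ (Vec.drop n m)

  insert-dropInBlock : ∀ {r} (ns : Vec ℕ r) (i : Fin r) (1≤nᵢ : 1 ≤ lookup ns i) e →
    lastOfBlock ns i e ≡ 0 → insertLastOfBlock ns i 1≤nᵢ (dropInBlock ns i e) ≡ e
  insert-dropInBlock (suc n ∷ ns) zero _ e last≡0 = begin
    (Vec.take n (Vec.init t Vec.++ d) Vec.∷ʳ 0) Vec.++ Vec.drop n (Vec.init t Vec.++ d)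
      ≡⟨ cong₂ (λ u w → (u Vec.∷ʳ 0) Vec.++ w) (take-++ (Vec.init t) d) (drop-++ (Vec.init t) d) ⟩
    (Vec.init t Vec.∷ʳ 0) Vec.++ d
      ≡⟨ cong (λ x → (Vec.init t Vec.∷ʳ x) Vec.++ d) last≡0 ⟨
    (Vec.init t Vec.∷ʳ Vec.last t) Vec.++ d
      ≡⟨ cong (Vec._++ d) (sym (proj₂ (proj₂ (Vec.initLast t)))) ⟩
    t Vec.++ d
      ≡⟨ VecP.take++drop≡id (suc n) e ⟩
    e ∎
    where
    t = Vec.take (suc n) e
    d = Vec.drop (suc n) e
  insert-dropInBlock (n ∷ ns) (suc i) 1≤nᵢ e last≡0 = begin
    Vec.take n v Vec.++ insertLastOfBlock ns i 1≤nᵢ (Vec.drop n v)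
      ≡⟨ cong₂ (λ u w → u Vec.++ insertLastOfBlock ns i 1≤nᵢ w)
               (take-++ (Vec.take n e) _) (drop-++ (Vec.take n e) _) ⟩
    Vec.take n e Vec.++ insertLastOfBlock ns i 1≤nᵢ (dropInBlock ns i (Vec.drop n e))
      ≡⟨ cong (Vec.take n e Vec.++_) (insert-dropInBlock ns i 1≤nᵢ (Vec.drop n e) last≡0) ⟩
    Vec.take n e Vec.++ Vec.drop n e
      ≡⟨ VecP.take++drop≡id n e ⟩
    e ∎
    where v = Vec.take n e Vec.++ dropInBlock ns i (Vec.drop n e)

coeff-Ξ : ∀ {r} (ns : Vec ℕ r) (i : Fin r) (1≤nᵢ : 1 ≤ lookup ns i) (p : Poly (Vec.sum ns)) m →
  coeff (Ξ ns i p) m ≡ coeff p (insertLastOfBlock ns i 1≤nᵢ m)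
coeff-Ξ ns i 1≤nᵢ p m =
  coeff-mapExponents-filter (dropInBlock ns i) (lastOfBlock ns i) (insert m) m
    (λ e last≡0 drop≡m → trans (sym (insert-dropInBlock ns i 1≤nᵢ e last≡0)) (cong insert drop≡m))
    (lastOfBlock-insert ns i 1≤nᵢ m) (dropInBlock-insert ns i 1≤nᵢ m) p
  where insert = insertLastOfBlock ns i 1≤nᵢ

-- The exponent vector γ

fillTo-suc : ∀ n (xs : List ℕ) → length xs ≤ n → fillTo (suc n) xs ≡ fillTo n xs Vec.∷ʳ 0
fillTo-suc zero [] _ = refl
fillTo-suc (suc n) [] _ = cong (0 ∷_) (fillTo-suc n [] z≤n)
fillTo-suc (suc n) (x ∷ xs) (s≤s ℓ≤n) = cong (x ∷_) (fillTo-suc n xs ℓ≤n)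

reverse-∷ʳ : ∀ {n} (v : Vec ℕ n) x → Vec.reverse (v Vec.∷ʳ x) ≡ x ∷ Vec.reverse v
reverse-∷ʳ [] x = refl
reverse-∷ʳ (y ∷ v) x = begin
  Vec.reverse (y ∷ (v Vec.∷ʳ x))      ≡⟨ VecP.reverse-∷ y (v Vec.∷ʳ x) ⟩
  Vec.reverse (v Vec.∷ʳ x) Vec.∷ʳ y   ≡⟨ cong (Vec._∷ʳ y) (reverse-∷ʳ v x) ⟩
  x ∷ (Vec.reverse v Vec.∷ʳ y)        ≡⟨ cong (x ∷_) (VecP.reverse-∷ y v) ⟨
  x ∷ Vec.reverse (y ∷ v)             ∎
  where open ≡-Reasoning

block-suc : ∀ n (xs : List ℕ) → length xs ≤ n → block (suc n) xs ≡ 0 ∷ block n xs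
block-suc n xs ℓ≤n = trans (cong Vec.reverse (fillTo-suc n xs ℓ≤n)) (reverse-∷ʳ (fillTo n xs) 0)

module _ {R : ℕ → ℕ → Set} where

  Linked-∷ʳ : ∀ {n} (u : Vec ℕ n) y x → VLinked R (u Vec.∷ʳ y) → R y x →
    VLinked R ((u Vec.∷ʳ y) Vec.∷ʳ x)
  Linked-∷ʳ [] y x _ Ryx = Ryx ∷ [-]
  Linked-∷ʳ (z ∷ []) y x (Rzy ∷ _) Ryx = Rzy ∷ Ryx ∷ [-]
  Linked-∷ʳ (z ∷ z′ ∷ u) y x (Rzz′ ∷ linked) Ryx = Rzz′ ∷ Linked-∷ʳ (z′ ∷ u) y x linked Ryx

  Linked-reverse : ∀ {n} (v : Vec ℕ n) → VLinked (flip R) v → VLinked R (Vec.reverse v)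
  Linked-reverse [] _ = []
  Linked-reverse (x ∷ v) linked = subst (VLinked R) (sym (VecP.reverse-∷ x v)) (reverse-∷ʳ-linked v x linked)
    where
    reverse-∷ʳ-linked : ∀ {n} (v : Vec ℕ n) x → VLinked (flip R) (x ∷ v) → VLinked R (Vec.reverse v Vec.∷ʳ x)
    reverse-∷ʳ-linked [] x _ = [-]
    reverse-∷ʳ-linked (y ∷ v) x (Ryx ∷ linked) =
      subst (λ u → VLinked R (u Vec.∷ʳ x)) (sym (VecP.reverse-∷ y v))
            (Linked-∷ʳ (Vec.reverse v) y x (reverse-∷ʳ-linked v y linked) Ryx)

fillTo-decreasing : ∀ n (xs : List ℕ) → Linked (λ a b → b ≤ a) xs → VLinked (λ a b → b ≤ a) (fillTo n xs)
fillTo-decreasing zero xs _ = []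
fillTo-decreasing (suc zero) [] _ = [-]
fillTo-decreasing (suc (suc n)) [] _ = z≤n ∷ fillTo-decreasing (suc n) [] []
fillTo-decreasing (suc zero) (x ∷ xs) _ = [-]
fillTo-decreasing (suc (suc n)) (x ∷ []) _ = z≤n ∷ fillTo-decreasing (suc n) [] []
fillTo-decreasing (suc (suc n)) (x ∷ y ∷ xs) (y≤x ∷ linked) = y≤x ∷ fillTo-decreasing (suc n) (y ∷ xs) linked

block-increasing : ∀ n (xs : List ℕ) → Linked (λ a b → b ≤ a) xs → VLinked _≤_ (block n xs)
block-increasing n xs linked = Linked-reverse (fillTo n xs) (fillTo-decreasing n xs linked)

Linked-lookup-++ : ∀ {n S} (b : Vec ℕ (suc n)) (w : Vec ℕ S) → VLinked _≤_ b →
  ∀ (j : Fin (n ℕ.+ S)) → toℕ j < n → lookup (b Vec.++ w) (inject₁ j) ≤ lookup (b Vec.++ w) (suc j)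
Linked-lookup-++ (x ∷ y ∷ b) w (x≤y ∷ _) zero _ = x≤y
Linked-lookup-++ (x ∷ y ∷ b) w (_ ∷ linked) (suc j) (s≤s j<n) = Linked-lookup-++ (y ∷ b) w linked j j<n

shift : ∀ n {S} → Fin (suc S) → Fin (suc (n ℕ.+ S))
shift zero p = p
shift (suc n) p = suc (shift n p)

toℕ-shift : ∀ n {S} (p : Fin (suc S)) → toℕ (shift n p) ≡ n ℕ.+ toℕ p
toℕ-shift zero p = refl
toℕ-shift (suc n) p = cong suc (toℕ-shift n p)

insertAt-shift-zero : ∀ n {S} (m : Vec ℕ (n ℕ.+ S)) →
  (Vec.take n m Vec.∷ʳ 0) Vec.++ Vec.drop n m ≡ insertAt m (shift n zero) 0
insertAt-shift-zero zero m = refl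
insertAt-shift-zero (suc n) (x ∷ m) = cong (x ∷_) (insertAt-shift-zero n m)

module _ {S : ℕ} where

  cast-++-insertAt : ∀ {n} (u : Vec ℕ n) (w : Vec ℕ S) (p : Fin (suc S)) x →
    Vec.cast (ℕP.+-suc n S) (u Vec.++ insertAt w p x) ≡ insertAt (u Vec.++ w) (shift n p) x
  cast-++-insertAt [] w p x = VecP.cast-is-id _ _
  cast-++-insertAt (y ∷ u) w p x = cong (y ∷_) (cast-++-insertAt u w p x)

  removeAt-cast-++ : ∀ {n} (u : Vec ℕ n) (w : Vec ℕ (suc S)) q →
    removeAt (Vec.cast (ℕP.+-suc n S) (u Vec.++ w)) (shift n q) ≡ u Vec.++ removeAt w q
  removeAt-cast-++ [] w q = cong (λ v → removeAt v q) (VecP.cast-is-id _ w)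
  removeAt-cast-++ (y ∷ []) (z ∷ w) q = cong (y ∷_) (removeAt-cast-++ [] (z ∷ w) q)
  removeAt-cast-++ (y ∷ y′ ∷ u) w q = cong (y ∷_) (removeAt-cast-++ (y′ ∷ u) w q)

  lookup-cast-++ : ∀ {n} (u : Vec ℕ n) (w : Vec ℕ (suc S)) q →
    lookup (Vec.cast (ℕP.+-suc n S) (u Vec.++ w)) (shift n q) ≡ lookup w q
  lookup-cast-++ [] w q = cong (λ v → lookup v q) (VecP.cast-is-id _ w)
  lookup-cast-++ (y ∷ u) w q = lookup-cast-++ u w q

  increasing-cast-++ : ∀ {n} (u : Vec ℕ n) (w : Vec ℕ (suc S)) q p → IncreasingBetween w q p →
    IncreasingBetween (Vec.cast (ℕP.+-suc n S) (u Vec.++ w)) (shift n q) (shift n p)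
  increasing-cast-++ [] w q p increasing = subst (λ v → IncreasingBetween v q p) (sym (VecP.cast-is-id _ w)) increasing
  increasing-cast-++ (y ∷ u) w q p increasing (suc j) (s≤s q≤j) (s≤s j<p) =
    increasing-cast-++ u w q p increasing j q≤j j<p

DeletionData-block : ∀ n {S} (xs : List ℕ) (w : Vec ℕ S) → Linked (λ a b → b ≤ a) xs → length xs ≤ n →
  DeletionData (block (suc n) xs Vec.++ w) (block n xs Vec.++ w) (λ m → (Vec.take n m Vec.∷ʳ 0) Vec.++ Vec.drop n m)
DeletionData-block n xs w decreasing ℓ≤n = record
  { N≡1+M = refl
  ; zeroPos = zero
  ; lastPos = shift n zero
  ; insert≡insertAt = λ m → trans (VecP.cast-is-id refl _) (insertAt-shift-zero n m)
  ; γ-zeroPos = trans (cong (λ v → lookup v zero) (VecP.cast-is-id refl γ))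
                      (cong (λ v → lookup (v Vec.++ w) zero) (block-suc n xs ℓ≤n))
  ; removeAt-zeroPos = trans (cong (λ v → removeAt v zero) (VecP.cast-is-id refl γ))
                             (cong (λ v → removeAt (v Vec.++ w) zero) (block-suc n xs ℓ≤n))
  ; zeroPos≤lastPos = z≤n
  ; increasing = λ j _ j<n → subst (λ v → lookup v (inject₁ j) ≤ lookup v (suc j)) (sym (VecP.cast-is-id refl γ))
      (Linked-lookup-++ (block (suc n) xs) w (block-increasing (suc n) xs decreasing) j
         (subst (toℕ j <_) (trans (toℕ-shift n zero) (ℕP.+-identityʳ n)) j<n))
  }
  where γ = block (suc n) xs Vec.++ w

DeletionData-prefix : ∀ {n N M} {γ : Vec ℕ N} {γ′ : Vec ℕ M} {insert : Vec ℕ M → Vec ℕ N} (u : Vec ℕ n) →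
  DeletionData γ γ′ insert →
  DeletionData (u Vec.++ γ) (u Vec.++ γ′) (λ m → Vec.take n m Vec.++ insert (Vec.drop n m))
DeletionData-prefix {n} {M = M} {γ} {γ′} {insert} u record
  { N≡1+M = refl ; zeroPos = q ; lastPos = p ; insert≡insertAt = insert≡insertAt ; γ-zeroPos = γ-zeroPos
  ; removeAt-zeroPos = removeAt-zeroPos ; zeroPos≤lastPos = q≤p ; increasing = increasing } = record
  { N≡1+M = ℕP.+-suc n M
  ; zeroPos = shift n q
  ; lastPos = shift n p
  ; insert≡insertAt = λ m → begin
      Vec.cast (ℕP.+-suc n M) (Vec.take n m Vec.++ insert (Vec.drop n m))
        ≡⟨ cong (λ v → Vec.cast (ℕP.+-suc n M) (Vec.take n m Vec.++ v)) (uncast (insert (Vec.drop n m))) ⟨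
      Vec.cast (ℕP.+-suc n M) (Vec.take n m Vec.++ Vec.cast refl (insert (Vec.drop n m)))
        ≡⟨ cong (λ v → Vec.cast (ℕP.+-suc n M) (Vec.take n m Vec.++ v)) (insert≡insertAt (Vec.drop n m)) ⟩
      Vec.cast (ℕP.+-suc n M) (Vec.take n m Vec.++ insertAt (Vec.drop n m) p 0)
        ≡⟨ cast-++-insertAt (Vec.take n m) (Vec.drop n m) p 0 ⟩
      insertAt (Vec.take n m Vec.++ Vec.drop n m) (shift n p) 0
        ≡⟨ cong (λ v → insertAt v (shift n p) 0) (VecP.take++drop≡id n m) ⟩
      insertAt m (shift n p) 0 ∎
  ; γ-zeroPos = trans (lookup-cast-++ u γ q) (trans (cong (λ v → lookup v q) (sym (uncast γ))) γ-zeroPos)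
  ; removeAt-zeroPos = trans (removeAt-cast-++ u γ q)
      (cong (u Vec.++_) (trans (cong (λ v → removeAt v q) (sym (uncast γ))) removeAt-zeroPos))
  ; zeroPos≤lastPos = subst₂ _≤_ (sym (toℕ-shift n q)) (sym (toℕ-shift n p)) (ℕP.+-monoʳ-≤ n q≤p)
  ; increasing = increasing-cast-++ u γ q p (subst (λ v → IncreasingBetween v q p) (uncast γ) increasing)
  }
  where
  open ≡-Reasoning
  uncast : (v : Vec ℕ (suc M)) → Vec.cast refl v ≡ v
  uncast = VecP.cast-is-id refl

gamma-deletionData : ∀ {r} (ns : Vec ℕ r) (lams : Vec (List ℕ) r) (i : Fin r) → IsPartition (lookup lams i) →
  (ℓ<nᵢ : suc (length (lookup lams i)) ≤ lookup ns i) →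
  DeletionData (gamma ns lams) (gamma (ns [ i ]%= pred) lams)
               (insertLastOfBlock ns i (ℕP.≤-trans (s≤s z≤n) ℓ<nᵢ))
gamma-deletionData (suc n ∷ ns) (xs ∷ lams) zero (decreasing , _) (s≤s ℓ≤n) =
  DeletionData-block n xs (gamma ns lams) decreasing ℓ≤n
gamma-deletionData (n ∷ ns) (xs ∷ lams) (suc i) partition ℓ<nᵢ =
  DeletionData-prefix (block n xs) (gamma-deletionData ns lams i partition ℓ<nᵢ)

mainTheorem10 : (K : ∀ {n} → Vec ℕ n → Poly n) → IsKeyPolynomials K →
    ∀ r (lams : Vec (List ℕ) r) (ns : Vec ℕ r) →
    (∀ j → IsPartition (lookup lams j)) →
    (∀ j → length (lookup lams j) ≤ lookup ns j) →
    (i : Fin r) → suc (length (lookup lams i)) ≤ lookup ns i →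
    Ξ ns i (S K ns lams) ≈ S K (ns [ i ]%= pred) lams
mainTheorem10 K isK r lams ns partitions _ i ℓ<nᵢ m = begin
  coeff (Ξ ns i (K (gamma ns lams))) m
    ≡⟨ coeff-Ξ ns i 1≤nᵢ (K (gamma ns lams)) m ⟩
  k (gamma ns lams) (insertLastOfBlock ns i 1≤nᵢ m)
    ≡⟨ k-deletion (gamma-deletionData ns lams i (partitions i) ℓ<nᵢ) m ⟩
  k (gamma (ns [ i ]%= pred) lams) m ∎
  where
  open ≡-Reasoning
  open KeyPolynomials K isK
  1≤nᵢ = ℕP.≤-trans (s≤s z≤n) ℓ<nᵢ
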